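{- Let $q$ be a prime power, let $M$ be a $\mathrm{GF}(q)$-representable matroid with a fixed $\mathrm{GF}(q)$-representation, let $S$ and $T$ be disjoint subsets of $E(M)$ with $\kappa_M(S,T) = k$, and let $(A,B)$ be a partition of $E(M)$ that is $S$-$T$-separating of order $k+1$. Let $(C,D)$ be a partition of $E(M)- (S\cup T)$ such that $\lambda_{M/C\setminus D}(S) = k$. Then $(M^+_{(A,B)}/C\setminus D)|X = M^+_{(A,B)}|X$.
   Context: For a matroid $M$ with ground set $E$, $\lambda_M(X) := r_M(X) + r_M(E- X) - r(M)$, and for disjoint $S,T\subseteq E$, $\kappa_M(S,T) := \min\{\lambda_M(X) : S \subseteq X \subseteq E- T\}$. A partition $(A,B)$ is $S$-$T$-separating of order $k+1$ if $S\subseteq A$, $T\subseteq B$ and $\lambda_M(A)=k$. Let $M=M[H]$ where $H$ is an $r\times E$ matrix over $\mathrm{GF}(q)$, $r=r(M)$, and let $\langle Y\rangle$ denote the span of the columns of $H$ indexed by $Y$. If $\lambda_M(A)=k$ for a partition $(A,B)$, then $\langle A\rangle\cap\langle B\rangle$ is a $k$-dimensional subspace of $\mathrm{GF}(q)^r$. $M^+_{(A,B)}$ denotes the matroid represented by $H$ together with $(q^k-1)/(q-1)$ new columns, labelled by a set $X$ disjoint from $E$, consisting of one nonzero vector from each $1$-dimensional subspace of $\langle A\rangle\cap\langle B\rangle$ (so $M^+_{(A,B)}|X\cong \mathrm{PG}(k-1,q)$ and $M^+_{(A,B)}\setminus X = M$). -}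

module Defs where

open import Level using (Level; _⊔_) renaming (suc to lsuc)
open import Algebra.Bundles using (CommutativeRing)
open import Relation.Binary.Definitions using (Decidable)
open import Relation.Nullary using (¬_)
open import Relation.Nullary.Decidable using (⌊_⌋)
open import Data.Nat using (ℕ; zero; suc; _+_; _∸_; _≤_) renaming (_⊔_ to _⊔ℕ_)
open import Data.Fin using (Fin; zero; suc; splitAt)
open import Data.Sum using ([_,_]′)
open import Data.Bool using (Bool; true; false; not; _∧_; _∨_; if_then_else_)
open import Data.List using (List; []; _∷_; map; foldr; concatMap; _++_)
open import Data.List.Relation.Unary.Any using (Any)
open import Data.Vec using (Vec; lookup)
import Data.Vec
open import Data.Fin.Subset using (Subset; ⊤; ⊥; ∁; _∩_; _∪_; _─_; _⊆_; ∣_∣)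
open import Data.Product using (Σ; ∃; _×_; _,_)
open import Relation.Binary.PropositionalEquality using (_≡_)

-- Finite fields (= GF(q) for the prime power q = number of elements).

record FiniteField (c ℓ : Level) : Set (lsuc (c ⊔ ℓ)) where
  field
    commRing : CommutativeRing c ℓ
  open CommutativeRing commRing public
  field
    1≉0      : ¬ (1# ≈ 0#)
    inverse  : ∀ x → ¬ (x ≈ 0#) → ∃ λ y → (x * y) ≈ 1#
    _≟_      : Decidable _≈_
    elements : List Carrier
    complete : ∀ x → Any (x ≈_) elements

-- Matroids on a subset ('ground') of Fin n, given by their rank function
-- (only its values on subsets of the ground set matter).

record SetMatroid (n : ℕ) : Set where
  field
    ground : Subset n
    rk     : Subset n → ℕ
open SetMatroid public

_/_ : ∀ {n} → SetMatroid n → Subset n → SetMatroid n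
M / C = record { ground = ground M ─ C ; rk = λ Y → rk M (Y ∪ C) ∸ rk M C }

_∖_ : ∀ {n} → SetMatroid n → Subset n → SetMatroid n
M ∖ D = record { ground = ground M ─ D ; rk = rk M }

infixl 6 _/_ _∖_ _∣_

_∣_ : ∀ {n} → SetMatroid n → Subset n → SetMatroid n
M ∣ X = record { ground = X ; rk = rk M }

conn : ∀ {n} → SetMatroid n → Subset n → ℕ
conn M Y = rk M Y + rk M (ground M ─ Y) ∸ rk M (ground M)

KappaIs : ∀ {n} → SetMatroid n → Subset n → Subset n → ℕ → Set
KappaIs M S T k =
  (Σ (Subset _) λ Y → S ⊆ Y × Y ⊆ (ground M ─ T) × conn M Y ≡ k)
  × (∀ Y → S ⊆ Y → Y ⊆ (ground M ─ T) → k ≤ conn M Y)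

MatroidEq : ∀ {n} → SetMatroid n → SetMatroid n → Set
MatroidEq M N = (ground M ≡ ground N) × (∀ Y → Y ⊆ ground M → rk M Y ≡ rk N Y)

allSubsets : ∀ {n} → List (Subset n)
allSubsets {zero}  = Data.Vec.[] ∷ []

allSubsets {suc n} = map (true Data.Vec.∷_) allSubsets ++ map (false Data.Vec.∷_) allSubsets

allFin : ∀ {n} → (Fin n → Bool) → Bool
allFin {zero}  f = true
allFin {suc n} f = f zero ∧ allFin (λ j → f (suc j))

module Linear {c ℓ} (F : FiniteField c ℓ) where
  open FiniteField F using (Carrier; _≈_; 0#; _*_; _≟_; elements) renaming (_+_ to _+ᶠ_)

  Vector : ℕ → Set c
  Vector r = Fin r → Carrier

  -- an r × n matrix, given by its columns
  Matrix : ℕ → ℕ → Set c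
  Matrix r n = Fin n → Vector r

  sumF : ∀ {n} → (Fin n → Carrier) → Carrier
  sumF {zero}  f = 0#
  sumF {suc n} f = f zero +ᶠ sumF (λ j → f (suc j))

  combo : ∀ {r n} → Matrix r n → (Fin n → Carrier) → Vector r
  combo H cf t = sumF (λ j → cf j * H j t)

  _≈ᵥ_ : ∀ {r} → Vector r → Vector r → Set ℓ
  u ≈ᵥ v = ∀ t → u t ≈ v t

  0ᵥ : ∀ {r} → Vector r
  0ᵥ t = 0#

  _·_ : ∀ {r} → Carrier → Vector r → Vector r
  (a · v) t = a * v t

  SupportedOn : ∀ {n} → (Fin n → Carrier) → Subset n → Set ℓ
  SupportedOn cf Y = ∀ j → ¬ (lookup Y j ≡ true) → cf j ≈ 0#

  InSpan : ∀ {r n} → Matrix r n → Subset n → Vector r → Set (c ⊔ ℓ)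
  InSpan H Y v = Σ (Fin _ → Carrier) λ cf → SupportedOn cf Y × combo H cf ≈ᵥ v

  -- all coefficient vectors (complete up to ≈, since 'elements' is)
  allCoeffs : ∀ {n} → List (Fin n → Carrier)
  allCoeffs {zero}  = (λ ()) ∷ []
  allCoeffs {suc n} =
    concatMap (λ x → map (λ cf → λ { zero → x ; (suc j) → cf j }) allCoeffs) elements

  isZero : ∀ {m} → (Fin m → Carrier) → Bool
  isZero v = allFin (λ t → ⌊ v t ≟ 0# ⌋)

  supported? : ∀ {n} → (Fin n → Carrier) → Subset n → Bool
  supported? cf Y = allFin (λ j → lookup Y j ∨ ⌊ cf j ≟ 0# ⌋)

  independent? : ∀ {r n} → Matrix r n → Subset n → Bool
  independent? H Z =
    foldr (λ cf b → (not (supported? cf Z ∧ isZero (combo H cf)) ∨ isZero cf) ∧ b)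
          true allCoeffs

  subset? : ∀ {n} → Subset n → Subset n → Bool
  subset? Z Y = allFin (λ j → not (lookup Z j) ∨ lookup Y j)

  rank : ∀ {r n} → Matrix r n → Subset n → ℕ
  rank H Y =
    foldr _⊔ℕ_ 0
      (map (λ Z → if subset? Z Y ∧ independent? H Z then ∣ Z ∣ else 0) allSubsets)

  M[_] : ∀ {r n} → Matrix r n → SetMatroid n
  M[ H ] = record { ground = ⊤ ; rk = rank H }

  -- H together with extra columns P (labelled by the last m elements)
  extend : ∀ {r n m} → Matrix r n → Matrix r m → Matrix r (n + m)
  extend {n = n} H P i = [ H , P ]′ (splitAt n i)

  -- P consists of exactly one nonzero vector from each 1-dimensional
  -- subspace of ⟨A⟩ ∩ ⟨B⟩, where B = E - A
  IsPlusPoints : ∀ {r n m} → Matrix r n → Subset n → Matrix r m → Set (c ⊔ ℓ)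
  IsPlusPoints H A P =
    (∀ i → ¬ (P i ≈ᵥ 0ᵥ))
    × (∀ i → InSpan H A (P i) × InSpan H (∁ A) (P i))
    × (∀ i j → ¬ (i ≡ j) → ¬ (∃ λ a → P i ≈ᵥ (a · P j)))
    × (∀ v → ¬ (v ≈ᵥ 0ᵥ) → InSpan H A v → InSpan H (∁ A) v
           → ∃ λ i → ∃ λ a → v ≈ᵥ (a · P i))

module Submission where

-- Let M = M[H], let (A, B) with B = E - A be a separation with λ(A) = k, and let the new
-- points X span ⟨A⟩ ∩ ⟨B⟩.  The restriction of M⁺ / C ∖ D to X is M⁺ | X as soon as
-- r⁺(Y ∪ C) = r⁺(Y) + r⁺(C) for all Y ⊆ X, i.e. as soon as ⟨A⟩ ∩ ⟨B⟩ ∩ ⟨C⟩ = 0.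
-- Suppose v ≠ 0 lies in all three spans.  Writing v = u + w with u ∈ ⟨A ∩ C⟩ and
-- w ∈ ⟨B ∩ C⟩, one of u, w is a nonzero vector of ⟨B⟩ ∩ ⟨A ∩ C⟩ or of ⟨A⟩ ∩ ⟨B ∩ C⟩,
-- and the skewness inequality r(P ∪ Q) + 1 ≤ r(P) + r(Q) (for a nonzero common vector
-- of ⟨P⟩ and ⟨Q⟩) together with submodularity gives
--   r(A ∪ C) + r(B ∪ C) + 1 ≤ r(A) + r(B) + r(C).
-- Two more submodular inequalities then force λ_{M/C∖D}(S) < λ_M(A) = k, contradicting
-- the hypothesis λ_{M/C∖D}(S) = k.

open import Defs
open import Level using () renaming (_⊔_ to _⊔ˡ_)
open import Data.Nat using (ℕ; zero; suc; _∸_; _≤_; _<_; z≤n; s≤s; s≤s⁻¹) renaming (_+_ to _+ℕ_; _⊔_ to _⊔ℕ_)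
import Data.Nat.Properties as ℕₚ
open import Data.Fin using (Fin; zero; suc; _↑ˡ_; _↑ʳ_; splitAt)
open import Data.Fin.Properties using (any?; suc-injective; splitAt-↑ˡ; splitAt-↑ʳ; splitAt⁻¹-↑ˡ; splitAt⁻¹-↑ʳ)
  renaming (_≟_ to _≟ᶠ_)
open import Data.Bool using (Bool; true; false; not; _∧_; _∨_; if_then_else_) renaming (_≟_ to _≟ᵇ_)
import Data.Bool.Properties as Boolₚ
open import Data.List using (List; []; _∷_; map; foldr; concatMap)
open import Data.List.Relation.Unary.Any as Any using (Any; here; there)
import Data.List.Relation.Unary.Any.Properties as Anyₚ
open import Data.Vec using (lookup; []; _∷_; _++_)
import Data.Vec as Vec
open import Data.Vec.Properties using ([]=⇒lookup; lookup⇒[]=; lookup-zipWith; lookup-map; lookup-replicate; lookup-++ˡ; lookup-++ʳ)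
open import Data.Fin.Subset using (Subset; _⊆_; ∣_∣; ⊥; ⊤; _∪_; _∩_; _─_; ∁; ⁅_⁆) renaming (_-_ to _⊖_)
open import Data.Fin.Subset.Properties using (∣⊥∣≡0; ∣⁅x⁆∣≡1; ∪-identityʳ; p─⊥≡p)
open import Data.Product using (Σ; ∃; _×_; _,_; proj₁; proj₂)
open import Data.Sum using (_⊎_; inj₁; inj₂; [_,_]′)
open import Data.Empty using (⊥-elim) renaming (⊥ to Empty)
open import Relation.Nullary using (¬_; yes; no; Dec)
open import Relation.Nullary.Decidable using (⌊_⌋; _×-dec_; ¬?)
open import Relation.Binary.PropositionalEquality as ≡ using (_≡_; _≢_)
open import Data.Maybe using (nothing)
import Algebra.Properties.Ring as RingProperties
import Algebra.Properties.Group as GroupProperties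
import Algebra.Solver.Ring.NaturalCoefficients as NaturalCoefficients
import Relation.Binary.Reasoning.Setoid as SetoidReasoning

-- Subsets of Fin n are Boolean vectors; membership is read off with 'lookup', the
-- form in which it occurs in 'SupportedOn'.

In : ∀ {n} → Subset n → Fin n → Set
In P x = lookup P x ≡ true

_⊑_ : ∀ {n} → Subset n → Subset n → Set
P ⊑ Q = ∀ x → In P x → In Q x

infix 4 _⊑_

-- the statement is phrased with the library's ⊆
⊆⇒⊑ : ∀ {n} {P Q : Subset n} → P ⊆ Q → P ⊑ Q
⊆⇒⊑ P⊆Q x x∈P = []=⇒lookup (P⊆Q (lookup⇒[]= x _ x∈P))

⊑-refl : ∀ {n} {P : Subset n} → P ⊑ P
⊑-refl x h = h

⊑-trans : ∀ {n} {P Q R : Subset n} → P ⊑ Q → Q ⊑ R → P ⊑ R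
⊑-trans PQ QR x h = QR x (PQ x h)

not-true : ∀ {b} → b ≢ true → b ≡ false
not-true {true}  h = ⊥-elim (h ≡.refl)
not-true {false} h = ≡.refl

false≢true : ∀ {b} → b ≡ false → b ≢ true
false≢true ≡.refl ()

∧-true : ∀ {a b} → a ∧ b ≡ true → a ≡ true × b ≡ true
∧-true {true} {true} _ = ≡.refl , ≡.refl

∧-intro : ∀ {a b} → a ≡ true → b ≡ true → a ∧ b ≡ true
∧-intro ≡.refl ≡.refl = ≡.refl

∨-true : ∀ {a b} → a ∨ b ≡ true → a ≡ true ⊎ b ≡ true
∨-true {true}  _ = inj₁ ≡.refl
∨-true {false} h = inj₂ h

lk-∪ : ∀ {n} (p q : Subset n) x → lookup (p ∪ q) x ≡ lookup p x ∨ lookup q x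
lk-∪ p q x = lookup-zipWith _∨_ x p q

lk-∩ : ∀ {n} (p q : Subset n) x → lookup (p ∩ q) x ≡ lookup p x ∧ lookup q x
lk-∩ p q x = lookup-zipWith _∧_ x p q

lk-∁ : ∀ {n} (p : Subset n) x → lookup (∁ p) x ≡ not (lookup p x)
lk-∁ p x = lookup-map x not p

lk-─ : ∀ {n} (p q : Subset n) x → lookup (p ─ q) x ≡ lookup p x ∧ not (lookup q x)
lk-─ (a ∷ p) (true  ∷ q) zero    = ≡.sym (Boolₚ.∧-zeroʳ a)
lk-─ (a ∷ p) (false ∷ q) zero    = ≡.sym (Boolₚ.∧-identityʳ a)
lk-─ (a ∷ p) (b ∷ q)     (suc x) = lk-─ p q x

lk-⊥ : ∀ {n} (x : Fin n) → lookup (⊥ {n}) x ≡ false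
lk-⊥ x = lookup-replicate x false

lk-⊤ : ∀ {n} (x : Fin n) → lookup (⊤ {n}) x ≡ true
lk-⊤ x = lookup-replicate x true

lk-⁅⁆-same : ∀ {n} (x : Fin n) → In ⁅ x ⁆ x
lk-⁅⁆-same zero    = ≡.refl
lk-⁅⁆-same (suc x) = lk-⁅⁆-same x

lk-⁅⁆-diff : ∀ {n} (x y : Fin n) → x ≢ y → lookup ⁅ y ⁆ x ≡ false
lk-⁅⁆-diff zero    zero    ne = ⊥-elim (ne ≡.refl)
lk-⁅⁆-diff zero    (suc y) ne = ≡.refl
lk-⁅⁆-diff (suc x) zero    ne = lk-⊥ x
lk-⁅⁆-diff (suc x) (suc y) ne = lk-⁅⁆-diff x y (λ e → ne (≡.cong suc e))

lk-⁅⁆-true : ∀ {n} (x y : Fin n) → In ⁅ y ⁆ x → x ≡ y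
lk-⁅⁆-true x y h with x ≟ᶠ y
... | yes e  = e
... | no  ne = ⊥-elim (false≢true (lk-⁅⁆-diff x y ne) h)

∪-inl : ∀ {n} (p q : Subset n) {x} → In p x → In (p ∪ q) x
∪-inl p q {x} h = ≡.trans (lk-∪ p q x) (≡.cong (_∨ lookup q x) h)

∪-inr : ∀ {n} (p q : Subset n) {x} → In q x → In (p ∪ q) x
∪-inr p q {x} h = ≡.trans (lk-∪ p q x) (≡.trans (≡.cong (lookup p x ∨_) h) (Boolₚ.∨-zeroʳ _))

∪-cases : ∀ {n} (p q : Subset n) {x} → In (p ∪ q) x → In p x ⊎ In q x
∪-cases p q {x} h = ∨-true (≡.trans (≡.sym (lk-∪ p q x)) h)

∩-elim : ∀ {n} (p q : Subset n) {x} → In (p ∩ q) x → In p x × In q x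
∩-elim p q {x} h = ∧-true (≡.trans (≡.sym (lk-∩ p q x)) h)

∩-intro : ∀ {n} (p q : Subset n) {x} → In p x → In q x → In (p ∩ q) x
∩-intro p q {x} hp hq = ≡.trans (lk-∩ p q x) (∧-intro hp hq)

∁-intro : ∀ {n} (p : Subset n) {x} → ¬ In p x → In (∁ p) x
∁-intro p {x} h = ≡.trans (lk-∁ p x) (≡.cong not (not-true h))

∁-elim : ∀ {n} (p : Subset n) {x} → In (∁ p) x → ¬ In p x
∁-elim p {x} h x∈p = false≢true (≡.trans (lk-∁ p x) (≡.cong not x∈p)) h

∪⁅⁆-cases : ∀ {n} (I : Subset n) e {x} → In (I ∪ ⁅ e ⁆) x → In I x ⊎ x ≡ e
∪⁅⁆-cases I e {x} h with ∪-cases I ⁅ e ⁆ h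
... | inj₁ i = inj₁ i
... | inj₂ s = inj₂ (lk-⁅⁆-true x e s)

⊖-keep : ∀ {n} (p : Subset n) {x} y → In p x → x ≢ y → In (p ⊖ y) x
⊖-keep p {x} y h ne = ≡.trans (lk-─ p ⁅ y ⁆ x) (≡.cong₂ (λ a b → a ∧ not b) h (lk-⁅⁆-diff x y ne))

⊖-self : ∀ {n} (p : Subset n) y → lookup (p ⊖ y) y ≡ false
⊖-self p y = ≡.trans (lk-─ p ⁅ y ⁆ y) (≡.trans (≡.cong (λ b → lookup p y ∧ not b) (lk-⁅⁆-same y)) (Boolₚ.∧-zeroʳ _))

⊖-⊑ : ∀ {n} (p : Subset n) y → p ⊖ y ⊑ p
⊖-⊑ p y x h = proj₁ (∧-true (≡.trans (≡.sym (lk-─ p ⁅ y ⁆ x)) h))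

subset-ext : ∀ {n} (p q : Subset n) → (∀ x → lookup p x ≡ lookup q x) → p ≡ q
subset-ext []      []      h = ≡.refl
subset-ext (a ∷ p) (b ∷ q) h = ≡.cong₂ _∷_ (h zero) (subset-ext p q (λ x → h (suc x)))

card-∪∩ : ∀ {n} (p q : Subset n) → ∣ p ∪ q ∣ +ℕ ∣ p ∩ q ∣ ≡ ∣ p ∣ +ℕ ∣ q ∣
card-∪∩ []         []         = ≡.refl
card-∪∩ (true ∷ p)  (true ∷ q)  = ≡.cong suc (≡.trans (ℕₚ.+-suc _ _) (≡.trans (≡.cong suc (card-∪∩ p q)) (≡.sym (ℕₚ.+-suc _ _))))
card-∪∩ (true ∷ p)  (false ∷ q) = ≡.cong suc (card-∪∩ p q)
card-∪∩ (false ∷ p) (true ∷ q)  = ≡.trans (≡.cong suc (card-∪∩ p q)) (≡.sym (ℕₚ.+-suc _ _))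
card-∪∩ (false ∷ p) (false ∷ q) = card-∪∩ p q

card-add : ∀ {n} (p : Subset n) x → lookup p x ≡ false → ∣ p ∪ ⁅ x ⁆ ∣ ≡ suc ∣ p ∣
card-add (false ∷ p) zero    h = ≡.cong (λ q → suc ∣ q ∣) (∪-identityʳ p)
card-add (true ∷ p)  (suc x) h = ≡.cong suc (card-add p x h)
card-add (false ∷ p) (suc x) h = card-add p x h

card-rem : ∀ {n} (p : Subset n) x → In p x → suc ∣ p ⊖ x ∣ ≡ ∣ p ∣
card-rem (true ∷ p)  zero    h = ≡.cong (λ q → suc ∣ q ∣) (p─⊥≡p p)
card-rem (true ∷ p)  (suc x) h = ≡.cong suc (card-rem p x h)
card-rem (false ∷ p) (suc x) h = card-rem p x h

card-pos : ∀ {n} (p : Subset n) x → In p x → 0 < ∣ p ∣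
card-pos p x h = ≡.subst (0 <_) (card-rem p x h) (s≤s z≤n)

nonempty : ∀ {n} (p : Subset n) → 0 < ∣ p ∣ → ∃ λ x → In p x
nonempty (true ∷ p)  h = zero , ≡.refl
nonempty (false ∷ p) h with nonempty p h
... | x , e = suc x , e

card-mono : ∀ {n} (p q : Subset n) → p ⊑ q → ∣ p ∣ ≤ ∣ q ∣
card-mono []          []          h = z≤n
card-mono (true ∷ p)  (true ∷ q)  h = s≤s (card-mono p q (λ x → h (suc x)))
card-mono (true ∷ p)  (false ∷ q) h with h zero ≡.refl
... | ()
card-mono (false ∷ p) (true ∷ q)  h = ℕₚ.m≤n⇒m≤1+n (card-mono p q (λ x → h (suc x)))
card-mono (false ∷ p) (false ∷ q) h = card-mono p q (λ x → h (suc x))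

split-view : ∀ n m (k : Fin (n +ℕ m)) → (∃ λ i → k ≡ i ↑ˡ m) ⊎ (∃ λ i → k ≡ n ↑ʳ i)
split-view n m k with splitAt n k in eq
... | inj₁ i = inj₁ (i , ≡.sym (splitAt⁻¹-↑ˡ eq))
... | inj₂ i = inj₂ (i , ≡.sym (splitAt⁻¹-↑ʳ eq))

card-++ : ∀ {n m} (p : Subset n) (q : Subset m) → ∣ p ++ q ∣ ≡ ∣ p ∣ +ℕ ∣ q ∣
card-++ []         q = ≡.refl
card-++ (true ∷ p)  q = ≡.cong suc (card-++ p q)
card-++ (false ∷ p) q = card-++ p q

card-++⊥ : ∀ {n m} (p : Subset n) → ∣ p ++ ⊥ {m} ∣ ≡ ∣ p ∣
card-++⊥ {m = m} p = ≡.trans (card-++ p ⊥) (≡.trans (≡.cong (∣ p ∣ +ℕ_) (∣⊥∣≡0 m)) (ℕₚ.+-identityʳ _))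

++-∪ : ∀ {n m} (p p' : Subset n) (q q' : Subset m) → (p ++ q) ∪ (p' ++ q') ≡ (p ∪ p') ++ (q ∪ q')
++-∪ []      []       q q' = ≡.refl
++-∪ (a ∷ p) (b ∷ p') q q' = ≡.cong ((a ∨ b) ∷_) (++-∪ p p' q q')

⊥∪⊥ : ∀ n → ⊥ {n} ∪ ⊥ ≡ ⊥
⊥∪⊥ zero    = ≡.refl
⊥∪⊥ (suc n) = ≡.cong (false ∷_) (⊥∪⊥ n)

card-disjoint-∪ : ∀ {n} (p q : Subset n) → (∀ x → In p x → In q x → Empty) → ∣ p ∪ q ∣ ≡ ∣ p ∣ +ℕ ∣ q ∣
card-disjoint-∪ {n} p q disjoint =
  ≡.trans (≡.sym (ℕₚ.+-identityʳ _)) (≡.trans (≡.cong (∣ p ∪ q ∣ +ℕ_) (≡.sym ∣p∩q∣≡0)) (card-∪∩ p q))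
  where
  ∣p∩q∣≡0 : ∣ p ∩ q ∣ ≡ 0
  ∣p∩q∣≡0 = ℕₚ.n≤0⇒n≡0 (≡.subst (∣ p ∩ q ∣ ≤_) (∣⊥∣≡0 n)
              (card-mono (p ∩ q) ⊥ (λ x h → ⊥-elim (disjoint x (proj₁ (∩-elim p q h)) (proj₂ (∩-elim p q h))))))

allFin-sound : ∀ {n} (f : Fin n → Bool) → allFin f ≡ true → ∀ j → f j ≡ true
allFin-sound {suc n} f h zero    = proj₁ (∧-true h)
allFin-sound {suc n} f h (suc j) = allFin-sound (λ j → f (suc j)) (proj₂ (∧-true h)) j

allFin-complete : ∀ {n} (f : Fin n → Bool) → (∀ j → f j ≡ true) → allFin f ≡ true
allFin-complete {zero}  f h = ≡.refl
allFin-complete {suc n} f h = ∧-intro (h zero) (allFin-complete (λ j → f (suc j)) (λ j → h (suc j)))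

allFin-false : ∀ {n} (f : Fin n → Bool) → allFin f ≡ false → ∃ λ j → f j ≡ false
allFin-false {suc n} f h with f zero in e
... | false = zero , e
... | true with allFin-false (λ j → f (suc j)) h
...   | j , e' = suc j , e'

allSubsets-complete : ∀ {n} (Z : Subset n) → Any (Z ≡_) allSubsets
allSubsets-complete {zero}  []        = here ≡.refl
allSubsets-complete {suc n} (true ∷ Z)  =
  Anyₚ.++⁺ˡ (Anyₚ.map⁺ (Any.map (≡.cong (true ∷_)) (allSubsets-complete Z)))
allSubsets-complete {suc n} (false ∷ Z) =
  Anyₚ.++⁺ʳ (map (true ∷_) allSubsets) (Anyₚ.map⁺ (Any.map (≡.cong (false ∷_)) (allSubsets-complete Z)))

max-ub : ∀ {a} {A : Set a} (h : A → ℕ) (L : List A) {x} → Any (x ≡_) L → h x ≤ foldr _⊔ℕ_ 0 (map h L)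
max-ub h (y ∷ L) (here ≡.refl) = ℕₚ.m≤m⊔n (h y) _
max-ub h (y ∷ L) (there p)     = ℕₚ.m≤n⇒m≤o⊔n (h y) (max-ub h L p)

max-attained : ∀ {a} {A : Set a} (h : A → ℕ) (L : List A) →
  foldr _⊔ℕ_ 0 (map h L) ≡ 0 ⊎ ∃ λ x → foldr _⊔ℕ_ 0 (map h L) ≡ h x
max-attained h []      = inj₁ ≡.refl
max-attained h (y ∷ L) with ℕₚ.⊔-sel (h y) (foldr _⊔ℕ_ 0 (map h L))
... | inj₁ e = inj₂ (y , e)
... | inj₂ e with max-attained h L
...   | inj₁ e'       = inj₁ (≡.trans e e')
...   | inj₂ (x , e') = inj₂ (x , ≡.trans e e')

-- Boolean combinations of five subsets S, T, C, D, A of Fin n, decided by truth tables.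
-- The hypotheses of the theorem pin down which membership patterns (s,t,c,d,a) occur;
-- every set inclusion used in the rank computations is then checked on the finitely
-- many admissible patterns.

data SetExpr : Set where
  `S `T `C `D `A `⊤ : SetExpr
  _`∪_ _`∩_ _`─_    : SetExpr → SetExpr → SetExpr
  `∁                : SetExpr → SetExpr

infixr 7 _`∩_
infixr 6 _`∪_
infixl 5 _`─_

Pattern : Set
Pattern = Bool → Bool → Bool → Bool → Bool → Bool

⟦_⟧ᵇ : SetExpr → Pattern
⟦ `S ⟧ᵇ      s t c d a = s
⟦ `T ⟧ᵇ      s t c d a = t
⟦ `C ⟧ᵇ      s t c d a = c
⟦ `D ⟧ᵇ      s t c d a = d
⟦ `A ⟧ᵇ      s t c d a = a
⟦ `⊤ ⟧ᵇ      s t c d a = true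
⟦ e `∪ f ⟧ᵇ  s t c d a = ⟦ e ⟧ᵇ s t c d a ∨ ⟦ f ⟧ᵇ s t c d a
⟦ e `∩ f ⟧ᵇ  s t c d a = ⟦ e ⟧ᵇ s t c d a ∧ ⟦ f ⟧ᵇ s t c d a
⟦ e `─ f ⟧ᵇ  s t c d a = ⟦ e ⟧ᵇ s t c d a ∧ not (⟦ f ⟧ᵇ s t c d a)
⟦ `∁ e ⟧ᵇ    s t c d a = not (⟦ e ⟧ᵇ s t c d a)

_⇒ᵇ_ : Bool → Bool → Bool
a ⇒ᵇ b = not a ∨ b

_⇔ᵇ_ : Bool → Bool → Bool
true  ⇔ᵇ b = b
false ⇔ᵇ b = not b

⇒ᵇ-elim : ∀ {a b} → a ⇒ᵇ b ≡ true → a ≡ true → b ≡ true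
⇒ᵇ-elim {true} h ≡.refl = h

⇔ᵇ-sound : ∀ a b → a ⇔ᵇ b ≡ true → a ≡ b
⇔ᵇ-sound true  true  _ = ≡.refl
⇔ᵇ-sound false false _ = ≡.refl

⇔ᵇ-refl : ∀ a → a ⇔ᵇ a ≡ true
⇔ᵇ-refl true  = ≡.refl
⇔ᵇ-refl false = ≡.refl

both : (Bool → Bool) → Bool
both g = g true ∧ g false

both-sound : ∀ g → both g ≡ true → ∀ b → g b ≡ true
both-sound g h true  = proj₁ (∧-true h)
both-sound g h false = proj₂ (∧-true h)

tautology? : Pattern → Bool
tautology? f = both λ s → both λ t → both λ c → both λ d → both λ a → f s t c d a

tautology-sound : ∀ f → tautology? f ≡ true → ∀ s t c d a → f s t c d a ≡ true
tautology-sound f h s t c d a =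
  both-sound (λ a → f s t c d a) (both-sound (λ d → both λ a → f s t c d a)
    (both-sound (λ c → both λ d → both λ a → f s t c d a)
      (both-sound (λ t → both λ c → both λ d → both λ a → f s t c d a)
        (both-sound (λ s → both λ t → both λ c → both λ d → both λ a → f s t c d a) h s) t) c) d) a

admissible : Pattern
admissible s t c d a =
  not (s ∧ t) ∧ not (c ∧ d) ∧ ((c ∨ d) ⇔ᵇ not (s ∨ t)) ∧ (s ⇒ᵇ a) ∧ (t ⇒ᵇ not a)

_⊑ᵖ_ : SetExpr → SetExpr → Pattern
(e ⊑ᵖ f) s t c d a = admissible s t c d a ⇒ᵇ (⟦ e ⟧ᵇ s t c d a ⇒ᵇ ⟦ f ⟧ᵇ s t c d a)

_≡ᵖ_ : SetExpr → SetExpr → Pattern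
(e ≡ᵖ f) s t c d a = admissible s t c d a ⇒ᵇ (⟦ e ⟧ᵇ s t c d a ⇔ᵇ ⟦ f ⟧ᵇ s t c d a)

module SetAlgebra {n} (S T C D A : Subset n)
  (S∩T≡⊥ : S ∩ T ≡ ⊥) (C∩D≡⊥ : C ∩ D ≡ ⊥) (C∪D≡∁S∪T : C ∪ D ≡ ∁ (S ∪ T))
  (S⊆A : S ⊆ A) (T⊆∁A : T ⊆ ∁ A) where

  ⟦_⟧ : SetExpr → Subset n
  ⟦ `S ⟧     = S
  ⟦ `T ⟧     = T
  ⟦ `C ⟧     = C
  ⟦ `D ⟧     = D
  ⟦ `A ⟧     = A
  ⟦ `⊤ ⟧     = ⊤
  ⟦ e `∪ f ⟧ = ⟦ e ⟧ ∪ ⟦ f ⟧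
  ⟦ e `∩ f ⟧ = ⟦ e ⟧ ∩ ⟦ f ⟧
  ⟦ e `─ f ⟧ = ⟦ e ⟧ ─ ⟦ f ⟧
  ⟦ `∁ e ⟧   = ∁ ⟦ e ⟧

  at : Pattern → Fin n → Bool
  at f x = f (lookup S x) (lookup T x) (lookup C x) (lookup D x) (lookup A x)

  lookup-⟦⟧ : ∀ e x → lookup ⟦ e ⟧ x ≡ at ⟦ e ⟧ᵇ x
  lookup-⟦⟧ `S x       = ≡.refl
  lookup-⟦⟧ `T x       = ≡.refl
  lookup-⟦⟧ `C x       = ≡.refl
  lookup-⟦⟧ `D x       = ≡.refl
  lookup-⟦⟧ `A x       = ≡.refl
  lookup-⟦⟧ `⊤ x       = lk-⊤ x
  lookup-⟦⟧ (e `∪ f) x = ≡.trans (lk-∪ ⟦ e ⟧ ⟦ f ⟧ x) (≡.cong₂ _∨_ (lookup-⟦⟧ e x) (lookup-⟦⟧ f x))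
  lookup-⟦⟧ (e `∩ f) x = ≡.trans (lk-∩ ⟦ e ⟧ ⟦ f ⟧ x) (≡.cong₂ _∧_ (lookup-⟦⟧ e x) (lookup-⟦⟧ f x))
  lookup-⟦⟧ (e `─ f) x = ≡.trans (lk-─ ⟦ e ⟧ ⟦ f ⟧ x) (≡.cong₂ (λ u v → u ∧ not v) (lookup-⟦⟧ e x) (lookup-⟦⟧ f x))
  lookup-⟦⟧ (`∁ e) x   = ≡.trans (lk-∁ ⟦ e ⟧ x) (≡.cong not (lookup-⟦⟧ e x))

  table-at : ∀ {f} → tautology? f ≡ true → ∀ x → at f x ≡ true
  table-at {f} table x = tautology-sound f table (lookup S x) (lookup T x) (lookup C x) (lookup D x) (lookup A x)

  admissible-at : ∀ x → at admissible x ≡ true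
  admissible-at x =
    ∧-intro (≡.cong not (pointwise S∩T≡⊥ (lk-∩ S T x)))
    (∧-intro (≡.cong not (pointwise C∩D≡⊥ (lk-∩ C D x)))
    (∧-intro (≡.trans (≡.cong (_⇔ᵇ not (lookup S x ∨ lookup T x)) CD) (⇔ᵇ-refl (not (lookup S x ∨ lookup T x))))
    (∧-intro (implies (λ h → ⊆⇒⊑ S⊆A x h))
             (implies (λ h → ≡.trans (≡.sym (lk-∁ A x)) (⊆⇒⊑ T⊆∁A x h))))))
    where
    pointwise : ∀ {p : Subset n} {b} → p ≡ ⊥ → lookup p x ≡ b → b ≡ false
    pointwise ≡.refl e = ≡.trans (≡.sym e) (lk-⊥ x)
    CD : lookup C x ∨ lookup D x ≡ not (lookup S x ∨ lookup T x)
    CD = ≡.trans (≡.sym (lk-∪ C D x)) (≡.trans (≡.cong (λ p → lookup p x) C∪D≡∁S∪T)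
           (≡.trans (lk-∁ (S ∪ T) x) (≡.cong not (lk-∪ S T x))))
    implies : ∀ {a b} → (a ≡ true → b ≡ true) → a ⇒ᵇ b ≡ true
    implies {false} h = ≡.refl
    implies {true}  h = h ≡.refl

  ⊑-by-table : ∀ e f → tautology? (e ⊑ᵖ f) ≡ true → ⟦ e ⟧ ⊑ ⟦ f ⟧
  ⊑-by-table e f table x x∈e =
    ≡.trans (lookup-⟦⟧ f x)
      (⇒ᵇ-elim (⇒ᵇ-elim (table-at {e ⊑ᵖ f} table x) (admissible-at x))
               (≡.trans (≡.sym (lookup-⟦⟧ e x)) x∈e))

  ≡-by-table : ∀ e f → tautology? (e ≡ᵖ f) ≡ true → ⟦ e ⟧ ≡ ⟦ f ⟧
  ≡-by-table e f table = subset-ext ⟦ e ⟧ ⟦ f ⟧ λ x →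
    ≡.trans (lookup-⟦⟧ e x)
      (≡.trans (⇔ᵇ-sound _ _ (⇒ᵇ-elim (table-at {e ≡ᵖ f} table x) (admissible-at x)))
               (≡.sym (lookup-⟦⟧ f x)))

module Arithmetic where
  open import Data.Nat using (_+_)
  open import Data.Nat.Properties
  open import Data.Nat.Tactic.RingSolver using (solve-∀)
  open import Relation.Binary.PropositionalEquality

  add-cancel : ∀ {x₁ x₂ y₁ y₂} w → x₁ + w ≤ y₁ → x₂ ≤ y₂ + w → x₁ + x₂ ≤ y₁ + y₂
  add-cancel {x₁} {x₂} {y₁} {y₂} w h₁ h₂ =
    +-cancelʳ-≤ w _ _ (subst₂ _≤_ (shuffle x₁ w x₂) (sym (+-assoc y₁ y₂ w)) (+-mono-≤ h₁ h₂))
    where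
    shuffle : ∀ x₁ w x₂ → (x₁ + w) + x₂ ≡ (x₁ + x₂) + w
    shuffle = solve-∀

  -- exchanging the roles of the two sides of a separation in the gap inequality
  gap-swap : ∀ {α β rA rB c} → β + (α + 1) ≤ (rB + c) + rA → α + (β + 1) ≤ (rA + c) + rB
  gap-swap {α} {β} {rA} {rB} {c} = subst₂ _≤_ (lhs α β) (rhs rA rB c)
    where
    lhs : ∀ α β → β + (α + 1) ≡ α + (β + 1)
    lhs = solve-∀
    rhs : ∀ rA rB c → (rB + c) + rA ≡ (rA + c) + rB
    rhs = solve-∀

  -- With a = r(S ∪ C), b = r(T ∪ C), e = r(S ∪ T ∪ C), c = r(C), R = r(E),
  -- α = r(A ∪ C), β = r(B ∪ C), rA = r(A), rB = r(B): the two submodular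
  -- inequalities and the gap inequality force λ_{M/C∖D}(S) < λ_M(A).
  connectivity-gap : ∀ {a b e c R α β rA rB} →
    c ≤ a → c ≤ b → c ≤ e → e + c ≤ a + b →
    a + (b + R) ≤ (α + e) + β → α + (β + 1) ≤ (rA + c) + rB →
    (a ∸ c) + (b ∸ c) ∸ (e ∸ c) < rA + rB ∸ R
  connectivity-gap {a} {b} {e} {c} {R} {α} {β} {rA} {rB} c≤a c≤b c≤e ec≤ab hS hA =
    m+n≤o⇒m≤o∸n (suc d) (+-cancelʳ-≤ (e + c) _ _ (+-cancelʳ-≤ (α + β) _ _ combined))
    where
    a' = a ∸ c
    b' = b ∸ c
    e' = e ∸ c
    d  = a' + b' ∸ e'
    a≡ : a' + c ≡ a
    a≡ = m∸n+n≡m c≤a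
    b≡ : b' + c ≡ b
    b≡ = m∸n+n≡m c≤b
    e≡ : e' + c ≡ e
    e≡ = m∸n+n≡m c≤e
    twice : ∀ x y c → (x + c) + (y + c) ≡ (x + y) + (c + c)
    twice = solve-∀
    once : ∀ x c → (x + c) + c ≡ x + (c + c)
    once = solve-∀
    e'≤a'+b' : e' ≤ a' + b'
    e'≤a'+b' = +-cancelʳ-≤ (c + c) _ _
      (subst₂ _≤_ (trans (cong (_+ c) (sym e≡)) (once e' c))
                  (trans (cong₂ _+_ (sym a≡) (sym b≡)) (twice a' b' c)) ec≤ab)
    d+e+c≡a+b : (d + e') + (c + c) ≡ a + b
    d+e+c≡a+b = trans (cong (_+ (c + c)) (m∸n+n≡m e'≤a'+b'))
                      (trans (sym (twice a' b' c)) (cong₂ _+_ a≡ b≡))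
    regroup₀ : ∀ a b R α β → (a + (b + R)) + (α + (β + 1)) ≡ (a + b) + (R + (α + (β + 1)))
    regroup₀ = solve-∀
    regroup₁ : ∀ d e' c R α β → (d + e') + (c + c) + (R + (α + (β + 1))) ≡ (suc d + R) + ((e' + c) + c) + (α + β)
    regroup₁ = solve-∀
    regroup₂ : ∀ α e β rA c rB → (α + e) + β + ((rA + c) + rB) ≡ (rA + rB) + (e + c) + (α + β)
    regroup₂ = solve-∀
    lhs : (a + (b + R)) + (α + (β + 1)) ≡ (suc d + R) + (e + c) + (α + β)
    lhs = begin
      (a + (b + R)) + (α + (β + 1))            ≡⟨ regroup₀ a b R α β ⟩
      (a + b) + (R + (α + (β + 1)))            ≡⟨ cong (_+ (R + (α + (β + 1)))) (sym d+e+c≡a+b) ⟩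
      (d + e') + (c + c) + (R + (α + (β + 1))) ≡⟨ regroup₁ d e' c R α β ⟩
      (suc d + R) + ((e' + c) + c) + (α + β)   ≡⟨ cong (λ z → (suc d + R) + (z + c) + (α + β)) e≡ ⟩
      (suc d + R) + (e + c) + (α + β)          ∎
      where open ≡-Reasoning
    combined : (suc d + R) + (e + c) + (α + β) ≤ (rA + rB) + (e + c) + (α + β)
    combined = subst₂ _≤_ lhs (regroup₂ α e β rA c rB) (+-mono-≤ hS hA)

module LinearAlgebra {c ℓ} (F : FiniteField c ℓ) where
  open FiniteField F hiding (zero)
  open Linear F
  open RingProperties ring using (-‿distribˡ-*; -‿distribʳ-*)
  open GroupProperties +-group using (inverseˡ-unique) renaming (ε⁻¹≈ε to -‿0; ⁻¹-involutive to -‿involutive)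
  open NaturalCoefficients commutativeSemiring (λ _ _ → nothing) using (solve; _:=_; _:+_; _:*_)
  module ≈-Reasoning = SetoidReasoning setoid

  cancel : ∀ {a b} → a + b ≈ 0# → a ≈ - b
  cancel {a} {b} = inverseˡ-unique a b

  sum-cong : ∀ {n} {f g : Fin n → Carrier} → (∀ j → f j ≈ g j) → sumF f ≈ sumF g
  sum-cong {zero}  h = refl
  sum-cong {suc n} h = +-cong (h zero) (sum-cong (λ j → h (suc j)))

  sum-+ : ∀ {n} (f g : Fin n → Carrier) → sumF (λ j → f j + g j) ≈ sumF f + sumF g
  sum-+ {zero}  f g = sym (+-identityʳ 0#)
  sum-+ {suc n} f g = trans (+-congˡ (sum-+ (λ j → f (suc j)) (λ j → g (suc j))))
                            (swap (f zero) (g zero) _ _)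
    where
    swap : ∀ a b c d → (a + b) + (c + d) ≈ (a + c) + (b + d)
    swap = solve 4 (λ a b c d → ((a :+ b) :+ (c :+ d)) := ((a :+ c) :+ (b :+ d))) refl

  sum-*ˡ : ∀ {n} a (f : Fin n → Carrier) → sumF (λ j → a * f j) ≈ a * sumF f
  sum-*ˡ {zero}  a f = sym (zeroʳ a)
  sum-*ˡ {suc n} a f = trans (+-congˡ (sum-*ˡ a (λ j → f (suc j)))) (sym (distribˡ a _ _))

  sum-0 : ∀ {n} {f : Fin n → Carrier} → (∀ j → f j ≈ 0#) → sumF f ≈ 0#
  sum-0 {zero}  h = refl
  sum-0 {suc n} h = trans (+-cong (h zero) (sum-0 (λ j → h (suc j)))) (+-identityˡ 0#)

  sum-neg : ∀ {n} (f : Fin n → Carrier) → sumF (λ j → - f j) ≈ - sumF f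
  sum-neg f = cancel (trans (sym (sum-+ (λ j → - f j) f)) (sum-0 (λ j → -‿inverseˡ (f j))))

  sum-swap : ∀ {n m} (g : Fin n → Fin m → Carrier) →
    sumF (λ i → sumF (λ j → g i j)) ≈ sumF (λ j → sumF (λ i → g i j))
  sum-swap {zero}  {m} g = sym (sum-0 {m} (λ j → refl))
  sum-swap {suc n} {m} g = begin
    sumF (λ j → g zero j) + sumF (λ i → sumF (λ j → g (suc i) j))
      ≈⟨ +-congˡ (sum-swap (λ i j → g (suc i) j)) ⟩
    sumF (λ j → g zero j) + sumF (λ j → sumF (λ i → g (suc i) j))
      ≈⟨ sym (sum-+ (λ j → g zero j) (λ j → sumF (λ i → g (suc i) j))) ⟩
    sumF (λ j → sumF (λ i → g i j)) ∎
    where open ≈-Reasoning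

  sum-single : ∀ {n} (f : Fin n → Carrier) j → (∀ i → i ≢ j → f i ≈ 0#) → sumF f ≈ f j
  sum-single f zero    h = trans (+-congˡ (sum-0 (λ i → h (suc i) (λ ())))) (+-identityʳ (f zero))
  sum-single f (suc j) h =
    trans (+-congʳ (h zero (λ ())))
          (trans (+-identityˡ _) (sum-single (λ i → f (suc i)) j (λ i ne → h (suc i) (λ e → ne (suc-injective e)))))

  sum-split : ∀ {n m} (f : Fin (n +ℕ m) → Carrier) →
    sumF f ≈ sumF (λ i → f (i ↑ˡ m)) + sumF (λ i → f (n ↑ʳ i))
  sum-split {zero}      f = sym (+-identityˡ _)
  sum-split {suc n} {m} f = trans (+-congˡ (sum-split {n} {m} (λ i → f (suc i)))) (sym (+-assoc _ _ _))

  δ : ∀ {n} → Fin n → Fin n → Carrier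
  δ j i with i ≟ᶠ j
  ... | yes _ = 1#
  ... | no  _ = 0#

  δ-same : ∀ {n} (j : Fin n) → δ j j ≈ 1#
  δ-same j with j ≟ᶠ j
  ... | yes _  = refl
  ... | no  ne = ⊥-elim (ne ≡.refl)

  δ-diff : ∀ {n} (j i : Fin n) → i ≢ j → δ j i ≈ 0#
  δ-diff j i ne with i ≟ᶠ j
  ... | yes e = ⊥-elim (ne e)
  ... | no  _ = refl

  sum-δ : ∀ {n} (j : Fin n) (f : Fin n → Carrier) → sumF (λ i → δ j i * f i) ≈ f j
  sum-δ j f = trans (sum-single (λ i → δ j i * f i) j
                       (λ i ne → trans (*-congʳ (δ-diff j i ne)) (zeroˡ (f i))))
                    (trans (*-congʳ (δ-same j)) (*-identityˡ (f j)))

  δ-supported : ∀ {n} (Z : Subset n) j → In Z j → SupportedOn (δ j) Z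
  δ-supported Z j j∈Z i i∉Z = δ-diff j i (λ e → i∉Z (≡.subst (In Z) (≡.sym e) j∈Z))

  combo-cong : ∀ {r n} (G : Matrix r n) {cf cf' : Fin n → Carrier} → (∀ j → cf j ≈ cf' j) →
    combo G cf ≈ᵥ combo G cf'
  combo-cong G h t = sum-cong (λ j → *-congʳ (h j))

  combo-+ : ∀ {r n} (G : Matrix r n) f g t → combo G (λ j → f j + g j) t ≈ combo G f t + combo G g t
  combo-+ G f g t = trans (sum-cong (λ j → distribʳ (G j t) (f j) (g j))) (sum-+ (λ j → f j * G j t) (λ j → g j * G j t))

  combo-neg : ∀ {r n} (G : Matrix r n) g t → combo G (λ j → - g j) t ≈ - combo G g t
  combo-neg G g t = trans (sum-cong (λ j → sym (-‿distribˡ-* (g j) (G j t)))) (sum-neg (λ j → g j * G j t))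

  combo-δ : ∀ {r n} (G : Matrix r n) j → combo G (δ j) ≈ᵥ G j
  combo-δ G j t = sum-δ j (λ i → G i t)

  combo-combo : ∀ {r n k} (G : Matrix r n) (x : Fin k → Carrier) (γ : Fin k → Fin n → Carrier) t →
    sumF (λ j → x j * combo G (γ j) t) ≈ combo G (λ l → sumF (λ j → x j * γ j l)) t
  combo-combo G x γ t = begin
    sumF (λ j → x j * sumF (λ l → γ j l * G l t))
      ≈⟨ sum-cong (λ j → sym (sum-*ˡ (x j) (λ l → γ j l * G l t))) ⟩
    sumF (λ j → sumF (λ l → x j * (γ j l * G l t)))
      ≈⟨ sum-swap (λ j l → x j * (γ j l * G l t)) ⟩
    sumF (λ l → sumF (λ j → x j * (γ j l * G l t)))
      ≈⟨ sum-cong (λ l → trans (sum-cong (λ j → sym (*-assoc (x j) (γ j l) (G l t))))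
                               (trans (sum-cong (λ j → *-comm (x j * γ j l) (G l t)))
                                      (trans (sum-*ˡ (G l t) (λ j → x j * γ j l)) (*-comm (G l t) _)))) ⟩
    sumF (λ l → sumF (λ j → x j * γ j l) * G l t) ∎
    where open ≈-Reasoning

  ⌊≟⌋-sound : ∀ {x y} → ⌊ x ≟ y ⌋ ≡ true → x ≈ y
  ⌊≟⌋-sound {x} {y} h with x ≟ y
  ... | yes p = p

  ⌊≟⌋-complete : ∀ {x y} → x ≈ y → ⌊ x ≟ y ⌋ ≡ true
  ⌊≟⌋-complete {x} {y} p with x ≟ y
  ... | yes _  = ≡.refl
  ... | no  np = ⊥-elim (np p)

  ⌊≟⌋-false : ∀ {x y} → ⌊ x ≟ y ⌋ ≡ false → ¬ x ≈ y
  ⌊≟⌋-false {x} {y} h with x ≟ y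
  ... | no np = np

  isZero-sound : ∀ {m} (v : Fin m → Carrier) → isZero v ≡ true → ∀ t → v t ≈ 0#
  isZero-sound v h t = ⌊≟⌋-sound (allFin-sound _ h t)

  isZero-complete : ∀ {m} (v : Fin m → Carrier) → (∀ t → v t ≈ 0#) → isZero v ≡ true
  isZero-complete v h = allFin-complete _ (λ t → ⌊≟⌋-complete (h t))

  isZero-false : ∀ {m} (v : Fin m → Carrier) → isZero v ≡ false → ∃ λ t → ¬ v t ≈ 0#
  isZero-false v h with allFin-false _ h
  ... | t , e = t , ⌊≟⌋-false e

  zero? : ∀ {r} (v : Vector r) → (v ≈ᵥ 0ᵥ) ⊎ ¬ (v ≈ᵥ 0ᵥ)
  zero? v with isZero v in e
  ... | true  = inj₁ (isZero-sound v e)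
  ... | false with isZero-false v e
  ...   | t , nz = inj₂ (λ h → nz (h t))

  supported-sound : ∀ {n} (cf : Fin n → Carrier) Y → supported? cf Y ≡ true → SupportedOn cf Y
  supported-sound cf Y h j j∉Y with lookup Y j | allFin-sound _ h j
  ... | true  | _ = ⊥-elim (j∉Y ≡.refl)
  ... | false | e = ⌊≟⌋-sound e

  supported-complete : ∀ {n} (cf : Fin n → Carrier) Y → SupportedOn cf Y → supported? cf Y ≡ true
  supported-complete cf Y h = allFin-complete _ λ j → lemma j (lookup Y j) ≡.refl
    where
    lemma : ∀ j b → lookup Y j ≡ b → b ∨ ⌊ cf j ≟ 0# ⌋ ≡ true
    lemma j true  e = ≡.refl
    lemma j false e = ⌊≟⌋-complete (h j (false≢true e))

  supported-cong : ∀ {n} {cf cf' : Fin n → Carrier} Y → (∀ j → cf j ≈ cf' j) → SupportedOn cf Y → SupportedOn cf' Y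
  supported-cong Y h s j j∉Y = trans (sym (h j)) (s j j∉Y)

  supported-mono : ∀ {n} {cf : Fin n → Carrier} {Y Z} → Y ⊑ Z → SupportedOn cf Y → SupportedOn cf Z
  supported-mono Y⊑Z s j j∉Z = s j (λ j∈Y → j∉Z (Y⊑Z j j∈Y))

  _≋_ : ∀ {n} → (Fin n → Carrier) → (Fin n → Carrier) → Set ℓ
  cf ≋ cf' = ∀ j → cf j ≈ cf' j

  allCoeffs-complete : ∀ {n} (cf : Fin n → Carrier) → Any (cf ≋_) allCoeffs
  allCoeffs-complete {zero}  cf = here (λ ())
  allCoeffs-complete {suc n} cf = through _ (λ _ _ → ≡.refl) (λ _ _ _ → ≡.refl) elements (complete (cf zero))
    where
    -- 'cons' abstracts the pattern lambda of 'allCoeffs', known only through its equations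
    through : (cons : Carrier → (Fin n → Carrier) → Fin (suc n) → Carrier) →
      (∀ x cf' → cons x cf' zero ≡ x) → (∀ x cf' j → cons x cf' (suc j) ≡ cf' j) →
      ∀ xs → Any (cf zero ≈_) xs → Any (cf ≋_) (concatMap (λ x → map (cons x) allCoeffs) xs)
    through cons cons-zero cons-suc (x ∷ xs) (here cf0≈x) =
      Anyₚ.++⁺ˡ (Anyₚ.map⁺ (Any.map matches (allCoeffs-complete (λ j → cf (suc j)))))
      where
      matches : ∀ {cf'} → (λ j → cf (suc j)) ≋ cf' → cf ≋ cons x cf'
      matches {cf'} tail zero    = ≡.subst (cf zero ≈_) (≡.sym (cons-zero x cf')) cf0≈x
      matches {cf'} tail (suc j) = ≡.subst (cf (suc j) ≈_) (≡.sym (cons-suc x cf' j)) (tail j)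
    through cons cons-zero cons-suc (x ∷ xs) (there p) =
      Anyₚ.++⁺ʳ (map (cons x) allCoeffs) (through cons cons-zero cons-suc xs p)

  Ind : ∀ {r n} → Matrix r n → Subset n → Set (c ⊔ˡ ℓ)
  Ind G Z = ∀ cf → SupportedOn cf Z → combo G cf ≈ᵥ 0ᵥ → ∀ j → cf j ≈ 0#

  Dep : ∀ {r n} → Matrix r n → Subset n → Set (c ⊔ˡ ℓ)
  Dep G Z = ∃ λ cf → SupportedOn cf Z × combo G cf ≈ᵥ 0ᵥ × ∃ λ j → ¬ cf j ≈ 0#

  Dep⇒¬Ind : ∀ {r n} (G : Matrix r n) Z → Dep G Z → ¬ Ind G Z
  Dep⇒¬Ind G Z (cf , s , z , j , nz) I = nz (I cf s z j)

  Ind-mono : ∀ {r n} (G : Matrix r n) {J Z} → Z ⊑ J → Ind G J → Ind G Z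
  Ind-mono G {J} {Z} Z⊑J indJ cf s z = indJ cf (supported-mono {Y = Z} {Z = J} Z⊑J s) z

  Ind-⊥ : ∀ {r n} (G : Matrix r n) → Ind G ⊥
  Ind-⊥ G cf s z j = s j (false≢true (lk-⊥ j))

  module IndependenceTest {r n} (G : Matrix r n) (Z : Subset n) where
    test : (Fin n → Carrier) → Bool
    test cf = not (supported? cf Z ∧ isZero (combo G cf)) ∨ isZero cf

    passes : ∀ {cf} → test cf ≡ true → SupportedOn cf Z → combo G cf ≈ᵥ 0ᵥ → ∀ j → cf j ≈ 0#
    passes {cf} h s z with supported? cf Z in es | isZero (combo G cf) in ez
    ... | true  | true  = isZero-sound cf h
    ... | false | _     = ⊥-elim (false≢true es (supported-complete cf Z s))
    ... | true  | false = ⊥-elim (false≢true ez (isZero-complete _ z))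

    fails : ∀ {cf} → test cf ≡ false → SupportedOn cf Z × combo G cf ≈ᵥ 0ᵥ × ∃ λ j → ¬ cf j ≈ 0#
    fails {cf} h with supported? cf Z in es | isZero (combo G cf) in ez | isZero cf in e0
    ... | true | true | false = supported-sound cf Z es , isZero-sound _ ez , isZero-false cf e0

    fold : List (Fin n → Carrier) → Bool
    fold = foldr (λ cf b → test cf ∧ b) true

    fold-true : ∀ L {cf} → fold L ≡ true → Any (cf ≋_) L → ∃ λ cf' → cf ≋ cf' × test cf' ≡ true
    fold-true (x ∷ L) h (here p)  = x , p , proj₁ (∧-true h)
    fold-true (x ∷ L) h (there p) = fold-true L (proj₂ (∧-true h)) p

    fold-complete : ∀ L → (∀ cf → test cf ≡ true) → fold L ≡ true
    fold-complete []      h = ≡.refl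
    fold-complete (x ∷ L) h = ∧-intro (h x) (fold-complete L h)

    fold-false : ∀ L → fold L ≡ false → ∃ λ cf → test cf ≡ false
    fold-false (x ∷ L) h with test x in e
    ... | false = x , e
    ... | true  = fold-false L h

    independent-sound : independent? G Z ≡ true → Ind G Z
    independent-sound h cf s z j with fold-true allCoeffs h (allCoeffs-complete cf)
    ... | cf' , cf≋cf' , ok =
      trans (cf≋cf' j) (passes ok (supported-cong Z cf≋cf' s) (λ t → trans (sym (combo-cong G cf≋cf' t)) (z t)) j)

    independent-complete : Ind G Z → independent? G Z ≡ true
    independent-complete I = fold-complete allCoeffs test-true
      where
      test-true : ∀ cf → test cf ≡ true
      test-true cf with supported? cf Z in es | isZero (combo G cf) in ez
      ... | false | _     = ≡.refl
      ... | true  | false = ≡.refl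
      ... | true  | true  = isZero-complete cf (I cf (supported-sound cf Z es) (isZero-sound _ ez))

    independent-false : independent? G Z ≡ false → Dep G Z
    independent-false h with fold-false allCoeffs h
    ... | cf , e = cf , fails e

  open IndependenceTest using (independent-sound; independent-complete; independent-false)

  Ind-or-Dep : ∀ {r n} (G : Matrix r n) Z → Ind G Z ⊎ Dep G Z
  Ind-or-Dep G Z with independent? G Z in e
  ... | true  = inj₁ (independent-sound G Z e)
  ... | false = inj₂ (independent-false G Z e)

  subset-sound : ∀ {n} (Z Y : Subset n) → subset? Z Y ≡ true → Z ⊑ Y
  subset-sound Z Y h x x∈Z with lookup Z x | allFin-sound _ h x
  ... | true | e = e

  subset-complete : ∀ {n} (Z Y : Subset n) → Z ⊑ Y → subset? Z Y ≡ true
  subset-complete Z Y h = allFin-complete _ λ j → lemma j (lookup Z j) ≡.refl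
    where
    lemma : ∀ j b → lookup Z j ≡ b → not b ∨ lookup Y j ≡ true
    lemma j true  e = h j e
    lemma j false e = ≡.refl

  module _ {r n} (G : Matrix r n) where

    size-if-independent : Subset n → Subset n → ℕ
    size-if-independent Y Z = if subset? Z Y ∧ independent? G Z then ∣ Z ∣ else 0

    rank-ub : ∀ Z Y → Z ⊑ Y → Ind G Z → ∣ Z ∣ ≤ rank G Y
    rank-ub Z Y Z⊑Y indZ =
      ≡.subst (_≤ rank G Y) value (max-ub (size-if-independent Y) allSubsets (allSubsets-complete Z))
      where
      value : size-if-independent Y Z ≡ ∣ Z ∣
      value rewrite subset-complete Z Y Z⊑Y | independent-complete G Z indZ = ≡.refl

    empty-basis : ∀ Y → rank G Y ≡ 0 → ∃ λ Z → Z ⊑ Y × Ind G Z × ∣ Z ∣ ≡ rank G Y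
    empty-basis Y e = ⊥ , (λ x h → ⊥-elim (false≢true (lk-⊥ x) h)) , Ind-⊥ G , ≡.trans (∣⊥∣≡0 n) (≡.sym e)

    basis : ∀ Y → ∃ λ Z → Z ⊑ Y × Ind G Z × ∣ Z ∣ ≡ rank G Y
    basis Y with max-attained (size-if-independent Y) allSubsets
    ... | inj₁ e = empty-basis Y e
    ... | inj₂ (Z , e) with subset? Z Y in e₁ | independent? G Z in e₂
    ...   | true  | true  = Z , subset-sound Z Y e₁ , independent-sound G Z e₂ , ≡.sym e
    ...   | true  | false = empty-basis Y e
    ...   | false | _     = empty-basis Y e

    rank-mono : ∀ Y Y' → Y ⊑ Y' → rank G Y ≤ rank G Y'
    rank-mono Y Y' Y⊑Y' with basis Y
    ... | Z , Z⊑Y , indZ , e = ≡.subst (_≤ rank G Y') e (rank-ub Z Y' (⊑-trans {P = Z} {Y} {Y'} Z⊑Y Y⊑Y') indZ)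

  -- Gaussian elimination: a homogeneous linear system with fewer equations than
  -- unknowns has a nontrivial solution.  Unknowns x j are indexed by j ∈ Z,
  -- equations Σⱼ x j · a j l = 0 by l ∈ L.

  Solution : ∀ {N} → Subset N → Subset N → (Fin N → Fin N → Carrier) → Set (c ⊔ˡ ℓ)
  Solution Z L a = ∃ λ x → SupportedOn x Z × (∃ λ j → ¬ x j ≈ 0#) ×
                             (∀ l → In L l → sumF (λ j → x j * a j l) ≈ 0#)

  drop-vacuous-equation : ∀ {N} (Z L : Subset N) a l₀ → (∀ j → In Z j → a j l₀ ≈ 0#) →
    Solution Z (L ⊖ l₀) a → Solution Z L a
  drop-vacuous-equation Z L a l₀ vacuous (x , x-supp , x≉0 , x-solves) = x , x-supp , x≉0 , solves
    where
    term-0 : ∀ j → x j * a j l₀ ≈ 0#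
    term-0 j with lookup Z j ≟ᵇ true
    ... | yes j∈Z = trans (*-congˡ (vacuous j j∈Z)) (zeroʳ _)
    ... | no  j∉Z = trans (*-congʳ (x-supp j j∉Z)) (zeroˡ _)
    solves : ∀ l → In L l → sumF (λ j → x j * a j l) ≈ 0#
    solves l l∈L with l ≟ᶠ l₀
    ... | yes ≡.refl = sum-0 term-0
    ... | no  l≢l₀   = x-solves l (⊖-keep L l₀ l∈L l≢l₀)

  -- Back-substitution through a pivot a j₀ l₀ ≉ 0: a solution of the system with
  -- unknown j₀ and equation l₀ eliminated extends to a solution of the whole system.
  module Pivot {N} (Z L : Subset N) (a : Fin N → Fin N → Carrier)
               (j₀ l₀ : Fin N) (j₀∈Z : In Z j₀) (pivot≉0 : ¬ a j₀ l₀ ≈ 0#) where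
    w : Carrier
    w = proj₁ (inverse (a j₀ l₀) pivot≉0)

    pivot*w : a j₀ l₀ * w ≈ 1#
    pivot*w = proj₂ (inverse (a j₀ l₀) pivot≉0)

    -- eliminate unknown j₀ using equation l₀: unknown j's coefficient in equation l
    -- loses (a j l₀ / a j₀ l₀) times that of unknown j₀
    reduced : Fin N → Fin N → Carrier
    reduced j l = a j l + - (a j₀ l * (w * a j l₀))

    -- x = y + t δ j₀ for a solution y of the reduced system, with t chosen so that
    -- the pivot equation l₀ holds
    module Extend (y : Fin N → Carrier)
                  (y-solves : ∀ l → In (L ⊖ l₀) l → sumF (λ j → y j * reduced j l) ≈ 0#) where
      open ≈-Reasoning
      σ : Carrier
      σ = sumF (λ j → y j * a j l₀)
      t : Carrier
      t = - (w * σ)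
      x : Fin N → Carrier
      x j = y j + δ j₀ j * t

      x-supported : SupportedOn y (Z ⊖ j₀) → SupportedOn x Z
      x-supported y-supp j j∉Z =
        trans (+-cong (y-supp j (λ h → j∉Z (⊖-⊑ Z j₀ j h))) (trans (*-congʳ (δ-supported Z j₀ j₀∈Z j j∉Z)) (zeroˡ t)))
              (+-identityˡ 0#)

      x-nontrivial : SupportedOn y (Z ⊖ j₀) → (∃ λ i → ¬ y i ≈ 0#) → ∃ λ j → ¬ x j ≈ 0#
      x-nontrivial y-supp (i , yi≉0) with i ≟ᶠ j₀
      ... | yes ≡.refl = ⊥-elim (yi≉0 (y-supp j₀ (false≢true (⊖-self Z j₀))))
      ... | no  i≢j₀   = i , λ xi≈0 → yi≉0 (trans (sym xi≈yi) xi≈0)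
        where
        xi≈yi : x i ≈ y i
        xi≈yi = trans (+-congˡ (trans (*-congʳ (δ-diff j₀ i i≢j₀)) (zeroˡ t))) (+-identityʳ (y i))

      at-x : ∀ l → sumF (λ j → x j * a j l) ≈ sumF (λ j → y j * a j l) + t * a j₀ l
      at-x l = begin
        sumF (λ j → (y j + δ j₀ j * t) * a j l)
          ≈⟨ sum-cong (λ j → distribʳ (a j l) (y j) (δ j₀ j * t)) ⟩
        sumF (λ j → y j * a j l + (δ j₀ j * t) * a j l)
          ≈⟨ sum-+ (λ j → y j * a j l) (λ j → (δ j₀ j * t) * a j l) ⟩
        sumF (λ j → y j * a j l) + sumF (λ j → (δ j₀ j * t) * a j l)
          ≈⟨ +-congˡ (trans (sum-cong (λ j → *-assoc (δ j₀ j) t (a j l))) (sum-δ j₀ (λ j → t * a j l))) ⟩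
        sumF (λ j → y j * a j l) + t * a j₀ l ∎

      pivot-equation : σ + t * a j₀ l₀ ≈ 0#
      pivot-equation = begin
        σ + - (w * σ) * a j₀ l₀   ≈⟨ +-congˡ (sym (-‿distribˡ-* (w * σ) (a j₀ l₀))) ⟩
        σ + - ((w * σ) * a j₀ l₀) ≈⟨ +-congˡ (-‿cong rescale) ⟩
        σ + - σ                   ≈⟨ -‿inverseʳ σ ⟩
        0# ∎
        where
        rescale : (w * σ) * a j₀ l₀ ≈ σ
        rescale = begin
          (w * σ) * a j₀ l₀   ≈⟨ solve 3 (λ w σ p → ((w :* σ) :* p) := (σ :* (p :* w))) refl w σ (a j₀ l₀) ⟩
          σ * (a j₀ l₀ * w)   ≈⟨ *-congˡ pivot*w ⟩
          σ * 1#              ≈⟨ *-identityʳ σ ⟩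
          σ ∎

      other-equation : ∀ l → In (L ⊖ l₀) l → sumF (λ j → y j * a j l) + t * a j₀ l ≈ 0#
      other-equation l l∈L' = trans (+-congʳ at-y) cancels
        where
        b = a j₀ l
        reduced-at-y : sumF (λ j → y j * reduced j l) ≈ sumF (λ j → y j * a j l) + - ((b * w) * σ)
        reduced-at-y = begin
          sumF (λ j → y j * (a j l + - (b * (w * a j l₀))))
            ≈⟨ sum-cong (λ j → trans (distribˡ (y j) _ _) (+-congˡ (trans (sym (-‿distribʳ-* (y j) _))
                 (-‿cong (solve 4 (λ y b w d → (y :* (b :* (w :* d))) := ((b :* w) :* (y :* d))) refl (y j) b w (a j l₀)))))) ⟩
          sumF (λ j → y j * a j l + - ((b * w) * (y j * a j l₀)))
            ≈⟨ sum-+ (λ j → y j * a j l) (λ j → - ((b * w) * (y j * a j l₀))) ⟩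
          sumF (λ j → y j * a j l) + sumF (λ j → - ((b * w) * (y j * a j l₀)))
            ≈⟨ +-congˡ (trans (sum-neg (λ j → (b * w) * (y j * a j l₀))) (-‿cong (sum-*ˡ (b * w) (λ j → y j * a j l₀)))) ⟩
          sumF (λ j → y j * a j l) + - ((b * w) * σ) ∎
        at-y : sumF (λ j → y j * a j l) ≈ (b * w) * σ
        at-y = trans (cancel (trans (sym reduced-at-y) (y-solves l l∈L'))) (-‿involutive _)
        cancels : (b * w) * σ + t * b ≈ 0#
        cancels = begin
          (b * w) * σ + - (w * σ) * b    ≈⟨ +-congˡ (sym (-‿distribˡ-* (w * σ) b)) ⟩
          (b * w) * σ + - ((w * σ) * b)  ≈⟨ +-congˡ (-‿cong (solve 3 (λ b w σ → ((w :* σ) :* b) := ((b :* w) :* σ)) refl b w σ)) ⟩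
          (b * w) * σ + - ((b * w) * σ)  ≈⟨ -‿inverseʳ _ ⟩
          0# ∎

      solves : ∀ l → In L l → sumF (λ j → x j * a j l) ≈ 0#
      solves l l∈L with l ≟ᶠ l₀
      ... | yes ≡.refl = trans (at-x l₀) pivot-equation
      ... | no  l≢l₀   = trans (at-x l) (other-equation l (⊖-keep L l₀ l∈L l≢l₀))

    back-substitute : Solution (Z ⊖ j₀) (L ⊖ l₀) reduced → Solution Z L a
    back-substitute (y , y-supp , y≉0 , y-solves) =
      x , x-supported y-supp , x-nontrivial y-supp y≉0 , solves
      where open Extend y y-solves

  -- Induction on the number s of equations: drop a vacuous equation, or eliminate a
  -- pivot and back-substitute.
  nontrivial-solution : ∀ {N} s (Z L : Subset N) a → ∣ L ∣ ≡ s → s < ∣ Z ∣ → Solution Z L a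
  nontrivial-solution zero Z L a ∣L∣≡0 0<∣Z∣ with nonempty Z 0<∣Z∣
  ... | j₀ , j₀∈Z = δ j₀ , δ-supported Z j₀ j₀∈Z , (j₀ , λ e → 1≉0 (trans (sym (δ-same j₀)) e)) , no-equations
    where
    no-equations : ∀ l → In L l → sumF (λ j → δ j₀ j * a j l) ≈ 0#
    no-equations l l∈L with ≡.subst (0 <_) ∣L∣≡0 (card-pos L l l∈L)
    ... | ()
  nontrivial-solution (suc s) Z L a ∣L∣≡1+s s+1<∣Z∣
    with nonempty L (≡.subst (0 <_) (≡.sym ∣L∣≡1+s) (s≤s z≤n))
  ... | l₀ , l₀∈L with any? (λ j → (lookup Z j ≟ᵇ true) ×-dec ¬? (a j l₀ ≟ 0#))
  ...   | no no-pivot = drop-vacuous-equation Z L a l₀ vacuous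
                          (nontrivial-solution s Z (L ⊖ l₀) a ∣L'∣≡s (ℕₚ.<-trans (ℕₚ.n<1+n s) s+1<∣Z∣))
    where
    ∣L'∣≡s : ∣ L ⊖ l₀ ∣ ≡ s
    ∣L'∣≡s = ℕₚ.suc-injective (≡.trans (card-rem L l₀ l₀∈L) ∣L∣≡1+s)
    vacuous : ∀ j → In Z j → a j l₀ ≈ 0#
    vacuous j j∈Z with a j l₀ ≟ 0#
    ... | yes e  = e
    ... | no  ne = ⊥-elim (no-pivot (j , j∈Z , ne))
  ...   | yes (j₀ , j₀∈Z , pivot≉0) = back-substitute
          (nontrivial-solution s (Z ⊖ j₀) (L ⊖ l₀) reduced ∣L'∣≡s s<∣Z'∣)
    where
    open Pivot Z L a j₀ l₀ j₀∈Z pivot≉0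
    ∣L'∣≡s : ∣ L ⊖ l₀ ∣ ≡ s
    ∣L'∣≡s = ℕₚ.suc-injective (≡.trans (card-rem L l₀ l₀∈L) ∣L∣≡1+s)
    s<∣Z'∣ : s < ∣ Z ⊖ j₀ ∣
    s<∣Z'∣ = s≤s⁻¹ (≡.subst (suc s <_) (≡.sym (card-rem Z j₀ j₀∈Z)) s+1<∣Z∣)

  span-self : ∀ {r n} (G : Matrix r n) Z j → In Z j → InSpan G Z (G j)
  span-self G Z j j∈Z = δ j , δ-supported Z j j∈Z , combo-δ G j

  span-resp : ∀ {r n} (G : Matrix r n) Z {u v} → u ≈ᵥ v → InSpan G Z u → InSpan G Z v
  span-resp G Z u≈v (cf , s , e) = cf , s , λ t → trans (e t) (u≈v t)

  span-mono : ∀ {r n} (G : Matrix r n) Y Z {v} → Y ⊑ Z → InSpan G Y v → InSpan G Z v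
  span-mono G Y Z Y⊑Z (cf , s , e) = cf , supported-mono {Y = Y} {Z = Z} Y⊑Z s , e

  span-minus : ∀ {r n} (G : Matrix r n) Z {u v} → InSpan G Z u → InSpan G Z v → InSpan G Z (λ t → u t + - v t)
  span-minus G Z (cu , su , eu) (cv , sv , ev) =
    (λ j → cu j + - cv j) ,
    (λ j j∉Z → trans (+-cong (su j j∉Z) (trans (-‿cong (sv j j∉Z)) -‿0)) (+-identityˡ 0#)) ,
    (λ t → trans (combo-+ G cu (λ j → - cv j) t) (+-cong (eu t) (trans (combo-neg G cv t) (-‿cong (ev t)))))

  module Substitution {r N} (G : Matrix r N) (K I : Subset N)
                      (K⊆⟨I⟩ : ∀ j → In K j → InSpan G I (G j)) where
    -- coefficients of column j (zero outside K)
    γ′ : ∀ j b → lookup K j ≡ b → Fin N → Carrier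
    γ′ j true  e = proj₁ (K⊆⟨I⟩ j e)
    γ′ j false e = λ _ → 0#

    γ : Fin N → Fin N → Carrier
    γ j = γ′ j (lookup K j) ≡.refl

    γ-supported : ∀ j → SupportedOn (γ j) I
    γ-supported j = go (lookup K j) ≡.refl
      where
      go : ∀ b (e : lookup K j ≡ b) → SupportedOn (γ′ j b e) I
      go true  e = proj₁ (proj₂ (K⊆⟨I⟩ j e))
      go false e = λ _ _ → refl

    γ-combo : ∀ j → In K j → combo G (γ j) ≈ᵥ G j
    γ-combo j = go (lookup K j) ≡.refl
      where
      go : ∀ b (e : lookup K j ≡ b) → b ≡ true → combo G (γ′ j b e) ≈ᵥ G j
      go true e _ = proj₂ (proj₂ (K⊆⟨I⟩ j e))

    substituted : (Fin N → Carrier) → Fin N → Carrier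
    substituted x l = sumF (λ j → x j * γ j l)

    substituted-supported : ∀ x → SupportedOn (substituted x) I
    substituted-supported x l l∉I = sum-0 (λ j → trans (*-congˡ (γ-supported j l l∉I)) (zeroʳ _))

    substitute : ∀ x → SupportedOn x K → combo G x ≈ᵥ combo G (substituted x)
    substitute x x-supp t = trans (sum-cong column) (combo-combo G x γ t)
      where
      column : ∀ j → x j * G j t ≈ x j * combo G (γ j) t
      column j with lookup K j ≟ᵇ true
      ... | yes j∈K = *-congˡ (sym (γ-combo j j∈K t))
      ... | no  j∉K = trans (*-congʳ (x-supp j j∉K)) (trans (zeroˡ _) (sym (trans (*-congʳ (x-supp j j∉K)) (zeroˡ _))))

  span-trans : ∀ {r N} (G : Matrix r N) K I {v} → (∀ j → In K j → InSpan G I (G j)) →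
    InSpan G K v → InSpan G I v
  span-trans G K I K⊆⟨I⟩ (cf , s , e) =
    substituted cf , substituted-supported cf , λ t → trans (sym (substitute cf s t)) (e t)
    where open Substitution G K I K⊆⟨I⟩

  -- Steinitz exchange: an independent set inside the span of I has at most ∣ I ∣ elements.
  -- Otherwise the system "substituted x = 0 on I" has a nontrivial solution x on K,
  -- a dependency among the columns of K.
  steinitz : ∀ {r N} (G : Matrix r N) K I → Ind G K → (∀ j → In K j → InSpan G I (G j)) → ∣ K ∣ ≤ ∣ I ∣
  steinitz G K I indK K⊆⟨I⟩ with ∣ K ∣ ℕₚ.≤? ∣ I ∣
  ... | yes ∣K∣≤∣I∣ = ∣K∣≤∣I∣
  ... | no  ∣K∣≰∣I∣ with nontrivial-solution (∣ I ∣) K I γ ≡.refl (ℕₚ.≰⇒> ∣K∣≰∣I∣)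
    where open Substitution G K I K⊆⟨I⟩
  ...   | x , x-supp , (j , xj≉0) , x-solves = ⊥-elim (xj≉0 (indK x x-supp dependency j))
    where
    open Substitution G K I K⊆⟨I⟩
    substituted-0 : ∀ l → substituted x l ≈ 0#
    substituted-0 l with lookup I l ≟ᵇ true
    ... | yes l∈I = x-solves l l∈I
    ... | no  l∉I = substituted-supported x l l∉I
    dependency : combo G x ≈ᵥ 0ᵥ
    dependency t = trans (substitute x x-supp t) (sum-0 λ l → trans (*-congʳ (substituted-0 l)) (zeroˡ _))

  dependent-extension : ∀ {r N} (G : Matrix r N) I e → Ind G I → Dep G (I ∪ ⁅ e ⁆) → InSpan G I (G e)
  dependent-extension {N = N} G I e indI (cf , s , dependency , j , cfj≉0) with cf e ≟ 0#
  ... | yes cfe≈0 = ⊥-elim (cfj≉0 (indI cf s-I dependency j))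
    where
    s-I : SupportedOn cf I
    s-I i i∉I with i ≟ᶠ e
    ... | yes ≡.refl = cfe≈0
    ... | no  i≢e    = s i λ h → [ i∉I , i≢e ]′ (∪⁅⁆-cases I e h)
  ... | no cfe≉0 = γ , γ-supp , γ-combo
    where
    open ≈-Reasoning
    w = proj₁ (inverse (cf e) cfe≉0)
    -- G e = - w Σ_{i ≠ e} cf i G i  (in each branch of γ-supp, δ e i computes to 1# resp. 0#)
    γ : Fin N → Carrier
    γ i = - (w * cf i) + δ e i
    γ-supp : SupportedOn γ I
    γ-supp i i∉I with i ≟ᶠ e
    ... | yes ≡.refl = trans (+-cong (-‿cong (trans (*-comm w (cf e)) (proj₂ (inverse (cf e) cfe≉0)))) refl) (-‿inverseˡ 1#)
    ... | no  i≢e = trans (+-cong (trans (-‿cong (trans (*-congˡ cfi≈0) (zeroʳ w))) -‿0) refl) (+-identityʳ 0#)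
      where
      cfi≈0 : cf i ≈ 0#
      cfi≈0 = s i λ h → [ i∉I , i≢e ]′ (∪⁅⁆-cases I e h)
    γ-combo : combo G γ ≈ᵥ G e
    γ-combo t = begin
      sumF (λ i → (- (w * cf i) + δ e i) * G i t)
        ≈⟨ combo-+ G (λ i → - (w * cf i)) (δ e) t ⟩
      sumF (λ i → - (w * cf i) * G i t) + combo G (δ e) t
        ≈⟨ +-cong scaled-dependency (combo-δ G e t) ⟩
      0# + G e t ≈⟨ +-identityˡ _ ⟩
      G e t ∎
      where
      scaled-dependency : sumF (λ i → - (w * cf i) * G i t) ≈ 0#
      scaled-dependency = begin
        sumF (λ i → - (w * cf i) * G i t)  ≈⟨ combo-neg G (λ i → w * cf i) t ⟩
        - sumF (λ i → (w * cf i) * G i t)  ≈⟨ -‿cong (trans (sum-cong (λ i → *-assoc w (cf i) (G i t))) (sum-*ˡ w (λ i → cf i * G i t))) ⟩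
        - (w * combo G cf t)               ≈⟨ -‿cong (trans (*-congˡ (dependency t)) (zeroʳ w)) ⟩
        - 0#                               ≈⟨ -‿0 ⟩
        0# ∎

  module _ {r N} (G : Matrix r N) where

    Ind? : ∀ Z → Dec (Ind G Z)
    Ind? Z with Ind-or-Dep G Z
    ... | inj₁ i = yes i
    ... | inj₂ d = no (Dep⇒¬Ind G Z d)

    augment : ∀ I K → Ind G I → Ind G K → ∣ I ∣ < ∣ K ∣ →
      ∃ λ e → In K e × lookup I e ≡ false × Ind G (I ∪ ⁅ e ⁆)
    augment I K indI indK ∣I∣<∣K∣
      with any? (λ e → (lookup K e ≟ᵇ true) ×-dec ((lookup I e ≟ᵇ false) ×-dec Ind? (I ∪ ⁅ e ⁆)))
    ... | yes found = found
    ... | no  none  = ⊥-elim (ℕₚ.<⇒≱ ∣I∣<∣K∣ (steinitz G K I indK K⊆⟨I⟩))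
      where
      K⊆⟨I⟩ : ∀ j → In K j → InSpan G I (G j)
      K⊆⟨I⟩ j j∈K with lookup I j ≟ᵇ true
      ... | yes j∈I = span-self G I j j∈I
      ... | no  j∉I with Ind-or-Dep G (I ∪ ⁅ j ⁆)
      ...   | inj₁ ind = ⊥-elim (none (j , j∈K , not-true j∉I , ind))
      ...   | inj₂ dep = dependent-extension G I j indI dep

    extend-to-basis : ∀ I Y → Ind G I → I ⊑ Y → ∃ λ J → I ⊑ J × J ⊑ Y × Ind G J × ∣ J ∣ ≡ rank G Y
    extend-to-basis I Y indI I⊑Y = go (rank G Y ∸ ∣ I ∣) I indI I⊑Y (⊑-refl {P = I}) (ℕₚ.m∸n+n≡m (rank-ub G I Y I⊑Y indI))
      where
      -- d counts the elements still missing from the growing independent set J ⊒ I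
      go : ∀ d J → Ind G J → J ⊑ Y → I ⊑ J → d +ℕ ∣ J ∣ ≡ rank G Y →
        ∃ λ J′ → I ⊑ J′ × J′ ⊑ Y × Ind G J′ × ∣ J′ ∣ ≡ rank G Y
      go zero    J indJ J⊑Y I⊑J e = J , I⊑J , J⊑Y , indJ , e
      go (suc d) J indJ J⊑Y I⊑J e with basis G Y
      ... | B , B⊑Y , indB , ∣B∣≡rY
        with augment J B indJ indB (≡.subst (∣ J ∣ <_) (≡.trans e (≡.sym ∣B∣≡rY)) (ℕₚ.m<n+m (∣ J ∣) (s≤s z≤n)))
      ...   | x , x∈B , x∉J , indJx =
        go d (J ∪ ⁅ x ⁆) indJx Jx⊑Y (λ y h → ∪-inl J ⁅ x ⁆ (I⊑J y h))
           (≡.trans (≡.cong (d +ℕ_) (card-add J x x∉J)) (≡.trans (ℕₚ.+-suc d _) e))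
        where
        Jx⊑Y : J ∪ ⁅ x ⁆ ⊑ Y
        Jx⊑Y y h with ∪⁅⁆-cases J x h
        ... | inj₁ y∈J    = J⊑Y y y∈J
        ... | inj₂ ≡.refl = B⊑Y y x∈B

    -- submodularity: r(X ∪ Y) + r(X ∩ Y) ≤ r(X) + r(Y).  Extend a basis I of X ∩ Y to a
    -- basis J of X ∪ Y and count J ∩ X and J ∩ Y.
    submodular : ∀ X Y → rank G (X ∪ Y) +ℕ rank G (X ∩ Y) ≤ rank G X +ℕ rank G Y
    submodular X Y with basis G (X ∩ Y)
    ... | I , I⊑X∩Y , indI , ∣I∣≡r∩
      with extend-to-basis I (X ∪ Y) indI (λ x h → ∪-inl X Y (proj₁ (∩-elim X Y (I⊑X∩Y x h))))
    ...   | J , I⊑J , J⊑X∪Y , indJ , ∣J∣≡r∪ = begin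
      rank G (X ∪ Y) +ℕ rank G (X ∩ Y)       ≡⟨ ≡.cong₂ _+ℕ_ (≡.sym ∣J∣≡r∪) (≡.sym ∣I∣≡r∩) ⟩
      ∣ J ∣ +ℕ ∣ I ∣                          ≤⟨ ℕₚ.+-mono-≤ (card-mono J (JX ∪ JY) J-split) (card-mono I (JX ∩ JY) I-inside) ⟩
      ∣ JX ∪ JY ∣ +ℕ ∣ JX ∩ JY ∣              ≡⟨ card-∪∩ JX JY ⟩
      ∣ JX ∣ +ℕ ∣ JY ∣                        ≤⟨ ℕₚ.+-mono-≤ (part X) (part Y) ⟩
      rank G X +ℕ rank G Y                    ∎
      where
      open ℕₚ.≤-Reasoning
      JX = J ∩ X
      JY = J ∩ Y
      part : ∀ Z → ∣ J ∩ Z ∣ ≤ rank G Z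
      part Z = rank-ub G (J ∩ Z) Z (λ x h → proj₂ (∩-elim J Z h))
                 (Ind-mono G {J} {J ∩ Z} (λ x h → proj₁ (∩-elim J Z h)) indJ)
      J-split : J ⊑ JX ∪ JY
      J-split x x∈J with ∪-cases X Y (J⊑X∪Y x x∈J)
      ... | inj₁ x∈X = ∪-inl JX JY (∩-intro J X x∈J x∈X)
      ... | inj₂ x∈Y = ∪-inr JX JY (∩-intro J Y x∈J x∈Y)
      I-inside : I ⊑ JX ∩ JY
      I-inside x x∈I with ∩-elim X Y (I⊑X∩Y x x∈I)
      ... | x∈X , x∈Y = ∩-intro JX JY (∩-intro J X (I⊑J x x∈I) x∈X) (∩-intro J Y (I⊑J x x∈I) x∈Y)

    basis-spans : ∀ I Z → I ⊑ Z → Ind G I → ∣ I ∣ ≡ rank G Z → ∀ j → In Z j → InSpan G I (G j)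
    basis-spans I Z I⊑Z indI ∣I∣≡rZ j j∈Z with lookup I j ≟ᵇ true
    ... | yes j∈I = span-self G I j j∈I
    ... | no  j∉I with Ind-or-Dep G (I ∪ ⁅ j ⁆)
    ...   | inj₂ dep = dependent-extension G I j indI dep
    ...   | inj₁ ind = ⊥-elim (ℕₚ.<⇒≱ too-big (ℕₚ.≤-reflexive (≡.sym ∣I∣≡rZ)))
      where
      Ij⊑Z : I ∪ ⁅ j ⁆ ⊑ Z
      Ij⊑Z y h with ∪⁅⁆-cases I j h
      ... | inj₁ y∈I    = I⊑Z y y∈I
      ... | inj₂ ≡.refl = j∈Z
      too-big : ∣ I ∣ < rank G Z
      too-big = ≡.subst (_≤ rank G Z) (card-add I j (not-true j∉I)) (rank-ub G (I ∪ ⁅ j ⁆) Z Ij⊑Z ind)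

    span-rank : ∀ Y Z → (∀ j → In Y j → InSpan G Z (G j)) → rank G Y ≤ rank G Z
    span-rank Y Z Y⊆⟨Z⟩ with basis G Z | basis G Y
    ... | I , I⊑Z , indI , ∣I∣≡rZ | J , J⊑Y , indJ , ∣J∣≡rY =
      ≡.subst₂ _≤_ ∣J∣≡rY ∣I∣≡rZ
        (steinitz G J I indJ (λ j j∈J → span-trans G Z I (basis-spans I Z I⊑Z indI ∣I∣≡rZ) (Y⊆⟨Z⟩ j (J⊑Y j j∈J))))

    Ind-⁅⁆ : ∀ x → ¬ (G x ≈ᵥ 0ᵥ) → Ind G ⁅ x ⁆
    Ind-⁅⁆ x Gx≉0 cf s dependency j with j ≟ᶠ x
    ... | no  j≢x    = s j (false≢true (lk-⁅⁆-diff j x j≢x))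
    ... | yes ≡.refl with cf j ≟ 0#
    ...   | yes cfj≈0 = cfj≈0
    ...   | no  cfj≉0 = ⊥-elim (Gx≉0 λ t → begin
            G j t               ≈⟨ sym (*-identityˡ _) ⟩
            1# * G j t          ≈⟨ *-congʳ (sym (trans (*-comm _ _) (proj₂ (inverse (cf j) cfj≉0)))) ⟩
            (w * cf j) * G j t  ≈⟨ *-assoc _ _ _ ⟩
            w * (cf j * G j t)  ≈⟨ *-congˡ (trans (sym (sum-single (λ i → cf i * G i t) j (only-j t))) (dependency t)) ⟩
            w * 0#              ≈⟨ zeroʳ w ⟩
            0# ∎)
      where
      open ≈-Reasoning
      w = proj₁ (inverse (cf j) cfj≉0)
      only-j : ∀ t i → i ≢ j → cf i * G i t ≈ 0#
      only-j t i i≢j = trans (*-congʳ (s i (false≢true (lk-⁅⁆-diff i j i≢j)))) (zeroˡ _)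

  restrict : ∀ {n} → Subset n → (Fin n → Carrier) → Fin n → Carrier
  restrict A cf j = if lookup A j then cf j else 0#

  restrictᶜ : ∀ {n} → Subset n → (Fin n → Carrier) → Fin n → Carrier
  restrictᶜ A cf j = if lookup A j then 0# else cf j

  restrict-sum : ∀ {n} (A : Subset n) cf j → restrict A cf j + restrictᶜ A cf j ≈ cf j
  restrict-sum A cf j with lookup A j
  ... | true  = +-identityʳ _
  ... | false = +-identityˡ _

  restrict-supported : ∀ {n} (A Y : Subset n) {cf} → SupportedOn cf Y → SupportedOn (restrict A cf) (A ∩ Y)
  restrict-supported A Y s j j∉A∩Y with lookup A j in j∈A
  ... | false = refl
  ... | true  = s j (λ j∈Y → j∉A∩Y (∩-intro A Y j∈A j∈Y))

  restrictᶜ-supported : ∀ {n} (A Y : Subset n) {cf} → SupportedOn cf Y → SupportedOn (restrictᶜ A cf) (∁ A ∩ Y)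
  restrictᶜ-supported A Y s j j∉B∩Y with lookup A j in j∈A
  ... | true  = refl
  ... | false = s j (λ j∈Y → j∉B∩Y (∩-intro (∁ A) Y (∁-intro A (false≢true j∈A)) j∈Y))

  combo-restrict : ∀ {r n} (G : Matrix r n) A cf t → combo G (restrict A cf) t + combo G (restrictᶜ A cf) t ≈ combo G cf t
  combo-restrict G A cf t = trans (sym (combo-+ G (restrict A cf) (restrictᶜ A cf) t)) (combo-cong G (restrict-sum A cf) t)

  span-split : ∀ {r n} (G : Matrix r n) A Y {v} → InSpan G Y v →
    Σ (Vector r) λ u → Σ (Vector r) λ w → InSpan G (A ∩ Y) u × InSpan G (∁ A ∩ Y) w × (∀ t → u t + w t ≈ v t)
  span-split G A Y (cf , s , e) =
    combo G (restrict A cf) , combo G (restrictᶜ A cf) ,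
    (restrict A cf , restrict-supported A Y s , λ t → refl) ,
    (restrictᶜ A cf , restrictᶜ-supported A Y s , λ t → refl) ,
    (λ t → trans (combo-restrict G A cf t) (e t))

  -- Appending columns Q to a matrix H: the old columns sit at i ↑ˡ m, the new ones at n ↑ʳ i.
  module Extension {r n m} (H : Matrix r n) (Q : Matrix r m) where
    G : Matrix r (n +ℕ m)
    G = extend H Q

    G-old : ∀ i t → G (i ↑ˡ m) t ≡ H i t
    G-old i t = ≡.cong (λ s → [ H , Q ]′ s t) (splitAt-↑ˡ n i m)

    G-new : ∀ i t → G (n ↑ʳ i) t ≡ Q i t
    G-new i t = ≡.cong (λ s → [ H , Q ]′ s t) (splitAt-↑ʳ n m i)

    combo-G : ∀ (cf : Fin (n +ℕ m) → Carrier) t →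
      combo G cf t ≈ combo H (λ i → cf (i ↑ˡ m)) t + sumF (λ i → cf (n ↑ʳ i) * Q i t)
    combo-G cf t = trans (sum-split {n} {m} (λ k → cf k * G k t))
      (+-cong (sum-cong (λ i → reflexive (≡.cong (cf (i ↑ˡ m) *_) (G-old i t))))
              (sum-cong (λ i → reflexive (≡.cong (cf (n ↑ʳ i) *_) (G-new i t)))))

    pad : (Fin n → Carrier) → Fin (n +ℕ m) → Carrier
    pad cf k = [ cf , (λ _ → 0#) ]′ (splitAt n k)

    pad-old : ∀ cf i → pad cf (i ↑ˡ m) ≡ cf i
    pad-old cf i = ≡.cong [ cf , (λ _ → 0#) ]′ (splitAt-↑ˡ n i m)

    pad-new : ∀ cf i → pad cf (n ↑ʳ i) ≡ 0#
    pad-new cf i = ≡.cong [ cf , (λ _ → 0#) ]′ (splitAt-↑ʳ n m i)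

    combo-pad : ∀ cf → combo G (pad cf) ≈ᵥ combo H cf
    combo-pad cf t = trans (combo-G (pad cf) t)
      (trans (+-cong (sum-cong (λ i → reflexive (≡.cong (_* H i t) (pad-old cf i))))
                     (sum-0 {m} (λ i → trans (reflexive (≡.cong (_* Q i t) (pad-new cf i))) (zeroˡ _))))
             (+-identityʳ _))

    pad-supported : ∀ cf (Z : Subset n) → SupportedOn cf Z → SupportedOn (pad cf) (Z ++ ⊥)
    pad-supported cf Z s k k∉Z with split-view n m k
    ... | inj₁ (i , ≡.refl) = trans (reflexive (pad-old cf i)) (s i (λ h → k∉Z (≡.trans (lookup-++ˡ Z ⊥ i) h)))
    ... | inj₂ (i , ≡.refl) = reflexive (pad-new cf i)

    unpad : (Fin (n +ℕ m) → Carrier) → Fin n → Carrier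
    unpad cf i = cf (i ↑ˡ m)

    unpad-supported : ∀ cf (Z : Subset n) → SupportedOn cf (Z ++ ⊥) → SupportedOn (unpad cf) Z
    unpad-supported cf Z s i i∉Z = s (i ↑ˡ m) (λ h → i∉Z (≡.trans (≡.sym (lookup-++ˡ Z ⊥ i)) h))

    new-coefficients-0 : ∀ cf (Z : Subset n) → SupportedOn cf (Z ++ ⊥) → ∀ (i : Fin m) → cf (n ↑ʳ i) ≈ 0#
    new-coefficients-0 cf Z s i = s (n ↑ʳ i) (λ h → false≢true (lk-⊥ i) (≡.trans (≡.sym (lookup-++ʳ Z ⊥ i)) h))

    combo-unpad : ∀ cf (Z : Subset n) → SupportedOn cf (Z ++ ⊥) → combo G cf ≈ᵥ combo H (unpad cf)
    combo-unpad cf Z s t = trans (combo-G cf t)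
      (trans (+-congˡ (sum-0 {m} (λ i → trans (*-congʳ (new-coefficients-0 cf Z s i)) (zeroˡ _)))) (+-identityʳ _))

    span-to-G : ∀ (Z : Subset n) {v} → InSpan H Z v → InSpan G (Z ++ ⊥) v
    span-to-G Z (cf , s , e) = pad cf , pad-supported cf Z s , λ t → trans (combo-pad cf t) (e t)

    span-from-G : ∀ (Z : Subset n) {v} → InSpan G (Z ++ ⊥) v → InSpan H Z v
    span-from-G Z (cf , s , e) = unpad cf , unpad-supported cf Z s , λ t → trans (sym (combo-unpad cf Z s t)) (e t)

    Ind-to-G : ∀ (Z : Subset n) → Ind H Z → Ind G (Z ++ ⊥)
    Ind-to-G Z indZ cf s z k with split-view n m k
    ... | inj₁ (i , ≡.refl) = indZ (unpad cf) (unpad-supported cf Z s) (λ t → trans (sym (combo-unpad cf Z s t)) (z t)) i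
    ... | inj₂ (i , ≡.refl) = new-coefficients-0 cf Z s i

    Ind-from-G : ∀ (Z : Subset n) → Ind G (Z ++ ⊥) → Ind H Z
    Ind-from-G Z indZ cf s z i = trans (sym (reflexive (pad-old cf i)))
      (indZ (pad cf) (pad-supported cf Z s) (λ t → trans (combo-pad cf t) (z t)) (i ↑ˡ m))

    rank-old : ∀ (Z : Subset n) → rank G (Z ++ ⊥) ≡ rank H Z
    rank-old Z = ℕₚ.≤-antisym ≤-old ≥-old
      where
      ≤-old : rank G (Z ++ ⊥) ≤ rank H Z
      ≤-old with basis G (Z ++ ⊥)
      ... | W , W⊑Z⊥ , indW , ∣W∣≡r with Vec.splitAt n W
      ...   | W₁ , W₂ , ≡.refl =
        ≡.subst (_≤ rank H Z) (≡.trans ∣W₁∣ ∣W∣≡r)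
          (rank-ub H W₁ Z W₁⊑Z (Ind-from-G W₁ (≡.subst (Ind G) (≡.cong (W₁ ++_) W₂≡⊥) indW)))
        where
        W₂≡⊥ : W₂ ≡ ⊥
        W₂≡⊥ = subset-ext W₂ ⊥ λ i → ≡.trans (not-true λ h → false≢true (lk-⊥ i)
                 (≡.trans (≡.sym (lookup-++ʳ Z ⊥ i)) (W⊑Z⊥ (n ↑ʳ i) (≡.trans (lookup-++ʳ W₁ W₂ i) h)))) (≡.sym (lk-⊥ i))
        W₁⊑Z : W₁ ⊑ Z
        W₁⊑Z i h = ≡.trans (≡.sym (lookup-++ˡ Z ⊥ i)) (W⊑Z⊥ (i ↑ˡ m) (≡.trans (lookup-++ˡ W₁ W₂ i) h))
        ∣W₁∣ : ∣ W₁ ∣ ≡ ∣ W₁ ++ W₂ ∣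
        ∣W₁∣ = ≡.sym (≡.trans (≡.cong (λ w → ∣ W₁ ++ w ∣) W₂≡⊥) (card-++⊥ W₁))
      ≥-old : rank H Z ≤ rank G (Z ++ ⊥)
      ≥-old with basis H Z
      ... | W , W⊑Z , indW , ∣W∣≡r =
        ≡.subst (_≤ rank G (Z ++ ⊥)) (≡.trans (card-++⊥ W) ∣W∣≡r) (rank-ub G (W ++ ⊥) (Z ++ ⊥) W⊥⊑Z⊥ (Ind-to-G W indW))
        where
        W⊥⊑Z⊥ : W ++ ⊥ ⊑ Z ++ ⊥
        W⊥⊑Z⊥ k h with split-view n m k
        ... | inj₁ (i , ≡.refl) = ≡.trans (lookup-++ˡ Z ⊥ i) (W⊑Z i (≡.trans (≡.sym (lookup-++ˡ W ⊥ i)) h))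
        ... | inj₂ (i , ≡.refl) = ⊥-elim (false≢true (lk-⊥ i) (≡.trans (≡.sym (lookup-++ʳ W ⊥ i)) h))

  module _ {r N} (G : Matrix r N) where

    rank-pos : ∀ Y x → In Y x → ¬ (G x ≈ᵥ 0ᵥ) → 1 ≤ rank G Y
    rank-pos Y x x∈Y Gx≉0 = ≡.subst (_≤ rank G Y) (∣⁅x⁆∣≡1 x) (rank-ub G ⁅ x ⁆ Y x⊑Y (Ind-⁅⁆ G x Gx≉0))
      where
      x⊑Y : ⁅ x ⁆ ⊑ Y
      x⊑Y y h = ≡.subst (In Y) (≡.sym (lk-⁅⁆-true y x h)) x∈Y

    -- the case of a vector that is a column x: compare with P ∪ {x} and Q ∪ {x}
    skew-column : ∀ P Q x → InSpan G P (G x) → InSpan G Q (G x) → ¬ (G x ≈ᵥ 0ᵥ) →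
      rank G (P ∪ Q) +ℕ 1 ≤ rank G P +ℕ rank G Q
    skew-column P Q x x∈⟨P⟩ x∈⟨Q⟩ Gx≉0 = begin
      rank G (P ∪ Q) +ℕ 1
        ≤⟨ ℕₚ.+-mono-≤ (rank-mono G (P ∪ Q) (P′ ∪ Q′) PQ⊑P′Q′) (rank-pos (P′ ∩ Q′) x x∈P′∩Q′ Gx≉0) ⟩
      rank G (P′ ∪ Q′) +ℕ rank G (P′ ∩ Q′)
        ≤⟨ submodular G P′ Q′ ⟩
      rank G P′ +ℕ rank G Q′
        ≤⟨ ℕₚ.+-mono-≤ (span-rank G P′ P (spanned P x∈⟨P⟩)) (span-rank G Q′ Q (spanned Q x∈⟨Q⟩)) ⟩
      rank G P +ℕ rank G Q ∎
      where
      open ℕₚ.≤-Reasoning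
      P′ = P ∪ ⁅ x ⁆
      Q′ = Q ∪ ⁅ x ⁆
      PQ⊑P′Q′ : P ∪ Q ⊑ P′ ∪ Q′
      PQ⊑P′Q′ y h with ∪-cases P Q h
      ... | inj₁ y∈P = ∪-inl P′ Q′ (∪-inl P ⁅ x ⁆ y∈P)
      ... | inj₂ y∈Q = ∪-inr P′ Q′ (∪-inl Q ⁅ x ⁆ y∈Q)
      x∈P′∩Q′ : In (P′ ∩ Q′) x
      x∈P′∩Q′ = ∩-intro P′ Q′ (∪-inr P ⁅ x ⁆ (lk-⁅⁆-same x)) (∪-inr Q ⁅ x ⁆ (lk-⁅⁆-same x))
      spanned : ∀ Z → InSpan G Z (G x) → ∀ j → In (Z ∪ ⁅ x ⁆) j → InSpan G Z (G j)
      spanned Z x∈⟨Z⟩ j h with ∪⁅⁆-cases Z x h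
      ... | inj₁ j∈Z    = span-self G Z j j∈Z
      ... | inj₂ ≡.refl = x∈⟨Z⟩

  -- For an arbitrary nonzero u ∈ ⟨P⟩ ∩ ⟨Q⟩: r(P ∪ Q) + 1 ≤ r(P) + r(Q).
  -- Append u as a new column, which changes no rank of old columns.
  skew : ∀ {r n} (H : Matrix r n) P Q (u : Vector r) → InSpan H P u → InSpan H Q u → ¬ (u ≈ᵥ 0ᵥ) →
    rank H (P ∪ Q) +ℕ 1 ≤ rank H P +ℕ rank H Q
  skew {r} {n} H P Q u u∈⟨P⟩ u∈⟨Q⟩ u≉0 =
    ≡.subst₂ _≤_ (≡.cong (_+ℕ 1) rank-union) (≡.cong₂ _+ℕ_ (rank-old P) (rank-old Q))
      (skew-column G (P ++ ⊥) (Q ++ ⊥) x (as-column (P ++ ⊥) (span-to-G P u∈⟨P⟩)) (as-column (Q ++ ⊥) (span-to-G Q u∈⟨Q⟩))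
                   (λ z → u≉0 (λ t → trans (sym (Gx≈u t)) (z t))))
    where
    open Extension H (λ _ → u)
    x = n ↑ʳ zero
    Gx≈u : G x ≈ᵥ u
    Gx≈u t = reflexive (G-new zero t)
    as-column : ∀ Z → InSpan G Z u → InSpan G Z (G x)
    as-column Z = span-resp G Z (λ t → sym (Gx≈u t))
    rank-union : rank G ((P ++ ⊥) ∪ (Q ++ ⊥)) ≡ rank H (P ∪ Q)
    rank-union = ≡.trans (≡.cong (rank G) (≡.trans (++-∪ P Q ⊥ ⊥) (≡.cong ((P ∪ Q) ++_) (⊥∪⊥ 1)))) (rank-old (P ∪ Q))

  Ind⇒nonzero : ∀ {r n} (G : Matrix r n) I x → Ind G I → In I x → ¬ (G x ≈ᵥ 0ᵥ)
  Ind⇒nonzero G I x indI x∈I Gx≈0 =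
    1≉0 (trans (sym (δ-same x)) (indI (δ x) (δ-supported I x x∈I) (λ t → trans (combo-δ G x t) (Gx≈0 t)) x))

  -- If ⟨I⟩ ∩ ⟨J⟩ = 0 and I, J are independent then so is I ∪ J: a dependency on I ∪ J
  -- splits into its parts on I and off I, whose combinations u and -u lie in ⟨I⟩ and ⟨J⟩.
  Ind-skew-union : ∀ {r n} (G : Matrix r n) I J → Ind G I → Ind G J →
    (∀ v → InSpan G I v → InSpan G J v → v ≈ᵥ 0ᵥ) → Ind G (I ∪ J)
  Ind-skew-union G I J indI indJ skewIJ cf s dependency j =
    trans (sym (restrict-sum I cf j)) (trans (+-cong (on-I-0 j) (on-J-0 j)) (+-identityˡ 0#))
    where
    on-I = restrict I cf
    on-J = restrictᶜ I cf
    on-I-supp : SupportedOn on-I I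
    on-I-supp = supported-mono {Y = I ∩ (I ∪ J)} {Z = I} (λ x h → proj₁ (∩-elim I (I ∪ J) h)) (restrict-supported I (I ∪ J) s)
    J-part : ∁ I ∩ (I ∪ J) ⊑ J
    J-part x h with ∩-elim (∁ I) (I ∪ J) h
    ... | x∈∁I , x∈I∪J with ∪-cases I J x∈I∪J
    ...   | inj₂ x∈J = x∈J
    ...   | inj₁ x∈I = ⊥-elim (∁-elim I x∈∁I x∈I)
    on-J-supp : SupportedOn on-J J
    on-J-supp = supported-mono {Y = ∁ I ∩ (I ∪ J)} {Z = J} J-part (restrictᶜ-supported I (I ∪ J) s)
    parts-cancel : ∀ t → combo G on-I t + combo G on-J t ≈ 0#
    parts-cancel t = trans (combo-restrict G I cf t) (dependency t)
    u-in-J : InSpan G J (combo G on-I)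
    u-in-J = (λ x → - on-J x) , (λ x x∉J → trans (-‿cong (on-J-supp x x∉J)) -‿0) ,
             (λ t → trans (combo-neg G on-J t) (sym (cancel (parts-cancel t))))
    u≈0 : combo G on-I ≈ᵥ 0ᵥ
    u≈0 = skewIJ _ (on-I , on-I-supp , λ t → refl) u-in-J
    on-I-0 : ∀ j → on-I j ≈ 0#
    on-I-0 = indI on-I on-I-supp u≈0
    on-J-0 : ∀ j → on-J j ≈ 0#
    on-J-0 = indJ on-J on-J-supp (λ t → trans (sym (+-identityˡ _)) (trans (+-congʳ (sym (u≈0 t))) (parts-cancel t)))

  -- Modularity for skew sets: if ⟨Y⟩ ∩ ⟨Z⟩ = 0 then r(Y ∪ Z) = r(Y) + r(Z), since the
  -- union of bases of Y and Z is then disjoint and independent.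
  rank-skew-union : ∀ {r n} (G : Matrix r n) Y Z → (∀ v → InSpan G Y v → InSpan G Z v → v ≈ᵥ 0ᵥ) →
    rank G (Y ∪ Z) ≡ rank G Y +ℕ rank G Z
  rank-skew-union G Y Z skewYZ = ℕₚ.≤-antisym (ℕₚ.≤-trans (ℕₚ.m≤m+n _ _) (submodular G Y Z)) ≥-sum
    where
    ≥-sum : rank G Y +ℕ rank G Z ≤ rank G (Y ∪ Z)
    ≥-sum with basis G Y | basis G Z
    ... | I , I⊑Y , indI , ∣I∣≡rY | J , J⊑Z , indJ , ∣J∣≡rZ =
      ≡.subst (_≤ rank G (Y ∪ Z)) (≡.trans (card-disjoint-∪ I J disjoint) (≡.cong₂ _+ℕ_ ∣I∣≡rY ∣J∣≡rZ))
        (rank-ub G (I ∪ J) (Y ∪ Z) IJ⊑YZ (Ind-skew-union G I J indI indJ skewIJ))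
      where
      skewIJ : ∀ v → InSpan G I v → InSpan G J v → v ≈ᵥ 0ᵥ
      skewIJ v v∈⟨I⟩ v∈⟨J⟩ = skewYZ v (span-mono G I Y I⊑Y v∈⟨I⟩) (span-mono G J Z J⊑Z v∈⟨J⟩)
      disjoint : ∀ x → In I x → In J x → Empty
      disjoint x x∈I x∈J = Ind⇒nonzero G I x indI x∈I (skewIJ (G x) (span-self G I x x∈I) (span-self G J x x∈J))
      IJ⊑YZ : I ∪ J ⊑ Y ∪ Z
      IJ⊑YZ x h with ∪-cases I J h
      ... | inj₁ x∈I = ∪-inl Y Z (I⊑Y x x∈I)
      ... | inj₂ x∈J = ∪-inr Y Z (J⊑Z x x∈J)

  -- Combining skewness with submodularity at P and C: if a nonzero vector lies in ⟨Q⟩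
  -- and in ⟨P ∩ C⟩ then r(P ∪ C) + r(Q ∪ (P ∩ C)) + 1 ≤ r(P) + r(C) + r(Q).
  skew-bound : ∀ {r n} (H : Matrix r n) P Q C u → InSpan H Q u → InSpan H (P ∩ C) u → ¬ (u ≈ᵥ 0ᵥ) →
    rank H (P ∪ C) +ℕ (rank H (Q ∪ (P ∩ C)) +ℕ 1) ≤ (rank H P +ℕ rank H C) +ℕ rank H Q
  skew-bound H P Q C u u∈⟨Q⟩ u∈⟨P∩C⟩ u≉0 =
    Arithmetic.add-cancel (rank H (P ∩ C)) (submodular H P C) (skew H Q (P ∩ C) u u∈⟨Q⟩ u∈⟨P∩C⟩ u≉0)

  module GutsAvoidC {r n} (H : Matrix r n) (S T C D A : Subset n) (k : ℕ)
    (S∩T≡⊥ : S ∩ T ≡ ⊥) (S⊆A : S ⊆ A) (T⊆∁A : T ⊆ ∁ A) (conn-A : conn M[ H ] A ≡ k)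
    (C∩D≡⊥ : C ∩ D ≡ ⊥) (C∪D≡∁S∪T : C ∪ D ≡ ∁ (S ∪ T)) (conn-S : conn (M[ H ] / C ∖ D) S ≡ k) where
    open SetAlgebra S T C D A S∩T≡⊥ C∩D≡⊥ C∪D≡∁S∪T S⊆A T⊆∁A
    open Arithmetic

    ρ : Subset n → ℕ
    ρ = rank H

    a b e rC R rA rB α β : ℕ
    a  = ρ (S ∪ C)
    b  = ρ (T ∪ C)
    e  = ρ (S ∪ T ∪ C)
    rC = ρ C
    R  = ρ ⊤
    rA = ρ A
    rB = ρ (∁ A)
    α  = ρ (A ∪ C)
    β  = ρ (∁ A ∪ C)

    mono : ∀ X Y → tautology? (X ⊑ᵖ Y) ≡ true → ρ ⟦ X ⟧ ≤ ρ ⟦ Y ⟧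
    mono X Y table = rank-mono H ⟦ X ⟧ ⟦ Y ⟧ (⊑-by-table X Y table)

    e+c≤a+b : e +ℕ rC ≤ a +ℕ b
    e+c≤a+b = ℕₚ.≤-trans (ℕₚ.+-mono-≤ (mono (`S `∪ `T `∪ `C) ((`S `∪ `C) `∪ (`T `∪ `C)) ≡.refl)
                                      (mono `C ((`S `∪ `C) `∩ (`T `∪ `C)) ≡.refl))
                         (submodular H (S ∪ C) (T ∪ C))

    a+b+R≤α+e+β : a +ℕ (b +ℕ R) ≤ (α +ℕ e) +ℕ β
    a+b+R≤α+e+β = add-cancel (ρ W) i₁ i₂
      where
      W = ∁ (D ∩ ∁ A)
      -- r(X) ≤ r(P ∩ Q) and r(Y) ≤ r(P ∪ Q) turn submodularity into r(X) + r(Y) ≤ r(P) + r(Q)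
      below : ∀ {u i s x y} → u +ℕ i ≤ s → x ≤ i → y ≤ u → x +ℕ y ≤ s
      below {u} {i} h x≤i y≤u =
        ℕₚ.≤-trans (ℕₚ.≤-trans (ℕₚ.+-mono-≤ x≤i y≤u) (ℕₚ.≤-reflexive (ℕₚ.+-comm i u))) h
      i₁ : a +ℕ ρ W ≤ α +ℕ e
      i₁ = below (submodular H (A ∪ C) (S ∪ T ∪ C))
                 (mono (`S `∪ `C) ((`A `∪ `C) `∩ (`S `∪ `T `∪ `C)) ≡.refl)
                 (mono (`∁ (`D `∩ `∁ `A)) ((`A `∪ `C) `∪ (`S `∪ `T `∪ `C)) ≡.refl)
      i₂ : b +ℕ R ≤ β +ℕ ρ W
      i₂ = below (submodular H (∁ A ∪ C) W)
                 (mono (`T `∪ `C) ((`∁ `A `∪ `C) `∩ `∁ (`D `∩ `∁ `A)) ≡.refl)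
                 (mono `⊤ ((`∁ `A `∪ `C) `∪ `∁ (`D `∩ `∁ `A)) ≡.refl)

    λ-A : rA +ℕ rB ∸ R ≡ k
    λ-A = ≡.trans (≡.cong (λ X → rA +ℕ ρ X ∸ R) (≡.sym (≡-by-table (`⊤ `─ `A) (`∁ `A) ≡.refl))) conn-A

    λ-S : (a ∸ rC) +ℕ (b ∸ rC) ∸ (e ∸ rC) ≡ k
    λ-S = ≡.trans (≡.cong₂ (λ X Y → (a ∸ rC) +ℕ (ρ X ∸ rC) ∸ (ρ Y ∸ rC))
                    (≡.sym (≡-by-table ((((`⊤ `─ `C) `─ `D) `─ `S) `∪ `C) (`T `∪ `C) ≡.refl))
                    (≡.sym (≡-by-table (((`⊤ `─ `C) `─ `D) `∪ `C) (`S `∪ `T `∪ `C) ≡.refl)))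
                  conn-S

    -- A nonzero v ∈ ⟨A⟩ ∩ ⟨B⟩ ∩ ⟨C⟩ splits as v = u + w with u ∈ ⟨A ∩ C⟩, w ∈ ⟨B ∩ C⟩.
    -- If u ≠ 0 then u = v - w ∈ ⟨B⟩; otherwise w = v ∈ ⟨A⟩.  Either way skewness gives
    -- r(A ∪ C) + r(B ∪ C) + 1 ≤ r(A) + r(C) + r(B).
    gap : ∀ v → InSpan H A v → InSpan H (∁ A) v → InSpan H C v → ¬ (v ≈ᵥ 0ᵥ) → α +ℕ (β +ℕ 1) ≤ (rA +ℕ rC) +ℕ rB
    gap v v∈⟨A⟩ v∈⟨B⟩ v∈⟨C⟩ v≉0 with span-split H A C v∈⟨C⟩
    ... | u , w , u∈⟨A∩C⟩ , w∈⟨B∩C⟩ , u+w≈v with zero? u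
    ...   | inj₂ u≉0 =
      ≡.subst (λ X → α +ℕ (ρ X +ℕ 1) ≤ (rA +ℕ rC) +ℕ rB) (≡-by-table (`∁ `A `∪ (`A `∩ `C)) (`∁ `A `∪ `C) ≡.refl)
        (skew-bound H A (∁ A) C u u∈⟨B⟩ u∈⟨A∩C⟩ u≉0)
      where
      v-w≈u : ∀ t → v t + - w t ≈ u t
      v-w≈u t = trans (+-congʳ (sym (u+w≈v t))) (trans (+-assoc _ _ _) (trans (+-congˡ (-‿inverseʳ _)) (+-identityʳ _)))
      u∈⟨B⟩ : InSpan H (∁ A) u
      u∈⟨B⟩ = span-resp H (∁ A) v-w≈u
                (span-minus H (∁ A) v∈⟨B⟩ (span-mono H (∁ A ∩ C) (∁ A) (λ x h → proj₁ (∩-elim (∁ A) C h)) w∈⟨B∩C⟩))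
    ...   | inj₁ u≈0 =
      gap-swap {α} {β} {rA} {rB} {rC}
        (≡.subst (λ X → β +ℕ (ρ X +ℕ 1) ≤ (rB +ℕ rC) +ℕ rA) (≡-by-table (`A `∪ (`∁ `A `∩ `C)) (`A `∪ `C) ≡.refl)
          (skew-bound H (∁ A) A C w w∈⟨A⟩ w∈⟨B∩C⟩ (λ w≈0 → v≉0 (λ t → trans (sym (w≈v t)) (w≈0 t)))))
      where
      w≈v : w ≈ᵥ v
      w≈v t = trans (sym (+-identityˡ _)) (trans (+-congʳ (sym (u≈0 t))) (u+w≈v t))
      w∈⟨A⟩ : InSpan H A w
      w∈⟨A⟩ = span-resp H A (λ t → sym (w≈v t)) v∈⟨A⟩

    -- ⟨A⟩ ∩ ⟨B⟩ ∩ ⟨C⟩ = 0, since a nonzero common vector contradicts λ_{M/C∖D}(S) = k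
    guts-avoid-C : ∀ v → InSpan H A v → InSpan H (∁ A) v → InSpan H C v → v ≈ᵥ 0ᵥ
    guts-avoid-C v v∈⟨A⟩ v∈⟨B⟩ v∈⟨C⟩ with zero? v
    ... | inj₁ v≈0 = v≈0
    ... | inj₂ v≉0 = ⊥-elim (ℕₚ.<-irrefl (≡.trans λ-S (≡.sym λ-A))
                       (connectivity-gap {a} {b} {e} {rC} {R} {α} {β} {rA} {rB}
                          c≤a c≤b c≤e e+c≤a+b a+b+R≤α+e+β (gap v v∈⟨A⟩ v∈⟨B⟩ v∈⟨C⟩ v≉0)))
      where
      c≤a : rC ≤ a
      c≤a = mono `C (`S `∪ `C) ≡.refl
      c≤b : rC ≤ b
      c≤b = mono `C (`T `∪ `C) ≡.refl
      c≤e : rC ≤ e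
      c≤e = mono `C (`S `∪ `T `∪ `C) ≡.refl

  -- Adjoining points P of ⟨A⟩ ∩ ⟨B⟩: if ⟨A⟩ ∩ ⟨B⟩ ∩ ⟨C⟩ = 0, contracting C does not change
  -- the rank of any set Y of new points.
  module NewPoints {r n m} (H : Matrix r n) (A C : Subset n) (P : Matrix r m)
    (P-in-guts : ∀ i → InSpan H A (P i) × InSpan H (∁ A) (P i))
    (guts-avoid-C : ∀ v → InSpan H A v → InSpan H (∁ A) v → InSpan H C v → v ≈ᵥ 0ᵥ) where
    open Extension H P

    X : Subset (n +ℕ m)
    X = ⊥ {n} ++ ⊤ {m}

    spanned-by-new : ∀ Z → (∀ i → InSpan H Z (P i)) → ∀ Y → Y ⊑ X → ∀ {v} → InSpan G Y v → InSpan H Z v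
    spanned-by-new Z P⊆⟨Z⟩ Y Y⊑X v∈⟨Y⟩ = span-from-G Z (span-trans G Y (Z ++ ⊥) columns v∈⟨Y⟩)
      where
      columns : ∀ j → In Y j → InSpan G (Z ++ ⊥) (G j)
      columns j j∈Y with split-view n m j
      ... | inj₁ (i , ≡.refl) = ⊥-elim (false≢true (lk-⊥ i) (≡.trans (≡.sym (lookup-++ˡ (⊥ {n}) (⊤ {m}) i)) (Y⊑X _ j∈Y)))
      ... | inj₂ (i , ≡.refl) = span-resp G (Z ++ ⊥) (λ t → sym (reflexive (G-new i t))) (span-to-G Z (P⊆⟨Z⟩ i))

    -- r⁺(Y ∪ C) - r⁺(C) = r⁺(Y) for Y ⊆ X, as ⟨Y⟩ ∩ ⟨C⟩ ⊆ ⟨A⟩ ∩ ⟨B⟩ ∩ ⟨C⟩ = 0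
    contraction-invisible : ∀ Y → Y ⊑ X → rank G (Y ∪ (C ++ ⊥)) ∸ rank G (C ++ ⊥) ≡ rank G Y
    contraction-invisible Y Y⊑X =
      ≡.trans (≡.cong (_∸ rank G (C ++ ⊥)) (rank-skew-union G Y (C ++ ⊥) Y-skew-C)) (ℕₚ.m+n∸n≡m (rank G Y) (rank G (C ++ ⊥)))
      where
      Y-skew-C : ∀ v → InSpan G Y v → InSpan G (C ++ ⊥) v → v ≈ᵥ 0ᵥ
      Y-skew-C v v∈⟨Y⟩ v∈⟨C⟩ =
        guts-avoid-C v (spanned-by-new A (λ i → proj₁ (P-in-guts i)) Y Y⊑X v∈⟨Y⟩)
                       (spanned-by-new (∁ A) (λ i → proj₂ (P-in-guts i)) Y Y⊑X v∈⟨Y⟩)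
                       (span-from-G C v∈⟨C⟩)

-- Lemma 4.1.  The restriction of M⁺ / C ∖ D to the new points X equals M⁺ | X: on
-- subsets Y of X, the rank of M⁺ / C ∖ D is r⁺(Y ∪ C) - r⁺(C) = r⁺(Y).
lemma4p1 : ∀ {c ℓ} (F : FiniteField c ℓ) → let open Linear F in
    ∀ {r n m} (H : Matrix r n) → rank H ⊤ ≡ r →
    (S T : Subset n) → S ∩ T ≡ ⊥ →
    (k : ℕ) → KappaIs M[ H ] S T k →
    (A : Subset n) → S ⊆ A → T ⊆ ∁ A → conn M[ H ] A ≡ k →
    (C D : Subset n) → C ∩ D ≡ ⊥ → C ∪ D ≡ ∁ (S ∪ T) →
    conn (M[ H ] / C ∖ D) S ≡ k →
    (P : Matrix r m) → IsPlusPoints H A P →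
    MatroidEq ((M[ extend H P ] / (C ++ ⊥) ∖ (D ++ ⊥)) ∣ (⊥ {n} ++ ⊤ {m}))
              (M[ extend H P ] ∣ (⊥ {n} ++ ⊤ {m}))
lemma4p1 F H _ S T S∩T≡⊥ k _ A S⊆A T⊆∁A conn-A C D C∩D≡⊥ C∪D≡∁S∪T conn-S P (_ , P-in-guts , _ , _) =
  ≡.refl , λ Y Y⊆X → contraction-invisible Y (⊆⇒⊑ Y⊆X)
  where
  open LinearAlgebra F
  open GutsAvoidC H S T C D A k S∩T≡⊥ S⊆A T⊆∁A conn-A C∩D≡⊥ C∪D≡∁S∪T conn-S using (guts-avoid-C)
  open NewPoints H A C P P-in-guts guts-avoid-C using (contraction-invisible)
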